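{- Let $G$ be a finite simple graph with $n$ vertices and $m\ge1$ edges, and let $B$ be a uniformly random ordering of $E(G)$. Then \[ \mathbb{E}(\kappa(G,B))\ge \frac{m}{\mathbb{E}(d')+1}, \] where $\mathbb{E}(d')=\frac1m\sum_{e\in E(G)}d'(e)$ is the average of $d'$ over the edges of $G$. Moreover, let $H$ be a graph chosen uniformly at random among all graphs on $n$ labelled vertices with exactly $m$ edges (i.e. $H\in G(n,m)$, with $1\le m\le\binom n2$), and let $B$ be a uniformly random ordering of $E(H)$. Then \[ \mathbb{E}(\kappa(H,B))\ge\frac{mn+m}{4m+n-3}, \] the expectation being over both $H$ and $B$.
   Context: For an ordering $B=(e_1,\dots,e_m)$ of the edges of a finite simple graph $G$, run the forest building process: start with no edges on $V(G)$ and for $j=1,\dots,m$ keep $e_j$ if and only if $e_j$ is incident to a vertex not incident to any $e_i$ with $i<j$. $\kappa(G,B)$ denotes the number of connected components of the resulting forest that contain at least one edge (isolated vertices of $G$ are not counted); when $G$ has no isolated vertices this is just the number of components of the resulting spanning forest. For an edge $e=uv$, $d'(e)=d(u)+d(v)-2$ is the number of other edges incident to $e$. -}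

module Defs where

open import Data.Bool using (Bool; true; false; _∧_; _∨_; not; if_then_else_)
open import Data.Nat using (ℕ; zero; suc; _+_; _∸_)
open import Data.Fin using (Fin; toℕ)
import Data.Nat as N
open import Data.Fin.Properties using (_≟_)
open import Data.List using (List; []; _∷_; [_]; map; _++_; concatMap; allFin; filterᵇ; length; cartesianProduct)
open import Data.Nat.ListAction using (sum)
open import Data.Bool.ListAction using (any; all)
open import Data.Product using (_×_; _,_; proj₁; proj₂)
open import Relation.Nullary.Decidable using (⌊_⌋)
open import Relation.Binary.PropositionalEquality using (_≡_)

_<ᵇ_ : ∀ {n} → Fin n → Fin n → Bool
i <ᵇ j = toℕ i N.<ᵇ toℕ j

-- An edge on vertex set Fin n, stored as (i , j) with i < j.
Edge : ℕ → Set
Edge n = Fin n × Fin n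

allPairs : (n : ℕ) → List (Edge n)
allPairs n = filterᵇ (λ p → proj₁ p <ᵇ proj₂ p) (cartesianProduct (allFin n) (allFin n))

record Graph (n : ℕ) : Set where
  field
    adj    : Fin n → Fin n → Bool
    sym    : ∀ i j → adj i j ≡ adj j i
    irrefl : ∀ i → adj i i ≡ false
open Graph public

edges : ∀ {n} → Graph n → List (Edge n)
edges {n} G = filterᵇ (λ p → adj G (proj₁ p) (proj₂ p)) (allPairs n)

degree : ∀ {n} → Graph n → Fin n → ℕ
degree {n} G v = length (filterᵇ (λ w → adj G v w) (allFin n))

d' : ∀ {n} → Graph n → Edge n → ℕ
d' G (u , v) = degree G u + degree G v ∸ 2

sumD' : ∀ {n} → Graph n → ℕ
sumD' G = sum (map (d' G) (edges G))

insertions : ∀ {A : Set} → A → List A → List (List A)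
insertions x []       = [ x ∷ [] ]
insertions x (y ∷ ys) = (x ∷ y ∷ ys) ∷ map (y ∷_) (insertions x ys)

perms : ∀ {A : Set} → List A → List (List A)
perms []       = [ [] ]
perms (x ∷ xs) = concatMap (insertions x) (perms xs)

choose : ∀ {A : Set} → ℕ → List A → List (List A)
choose zero    _        = [ [] ]
choose (suc k) []       = []
choose (suc k) (x ∷ xs) = map (x ∷_) (choose k xs) ++ choose (suc k) xs

_==_ : ∀ {n} → Fin n → Fin n → Bool
i == j = ⌊ i ≟ j ⌋

incident : ∀ {n} → Fin n → Edge n → Bool
incident w (u , v) = (w == u) ∨ (w == v)

touched : ∀ {n} → List (Edge n) → Fin n → Bool
touched F w = any (incident w) F

buildFrom : ∀ {n} → List (Edge n) → List (Edge n) → List (Edge n)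
buildFrom seen []             = []
buildFrom seen ((u , v) ∷ es) =
  if not (touched seen u) ∨ not (touched seen v)
  then (u , v) ∷ buildFrom ((u , v) ∷ seen) es
  else buildFrom ((u , v) ∷ seen) es

forest : ∀ {n} → List (Edge n) → List (Edge n)
forest B = buildFrom [] B

walk : ∀ {n} → ℕ → List (Edge n) → Fin n → Fin n → Bool
walk zero    F u v = u == v
walk (suc k) F u v = walk k F u v ∨
  any (λ e → (u == proj₁ e ∧ walk k F (proj₂ e) v) ∨ (u == proj₂ e ∧ walk k F (proj₁ e) v)) F

connected : ∀ {n} → List (Edge n) → Fin n → Fin n → Bool
connected {n} F u v = walk n F u v

-- Number of connected components of (Fin n , F) containing at least one edge:
-- count vertices w incident to an edge of F that are the least vertex of
-- their component.
componentsWithEdge : ∀ {n} → List (Edge n) → ℕ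
componentsWithEdge {n} F =
  length (filterᵇ (λ w → touched F w ∧ all (λ x → not (x <ᵇ w) ∨ not (connected F w x)) (allFin n)) (allFin n))

κ : ∀ {n} → List (Edge n) → ℕ
κ B = componentsWithEdge (forest B)

sumκ : ∀ {n} → List (Edge n) → ℕ
sumκ E = sum (map κ (perms E))

-- Call an edge a seed of an ordering B if it precedes in B every other edge sharing a vertex
-- with it.  A seed is kept by the process and starts a tree of its own, so κ(G,B) is at least
-- the number of seeds of B.  For a fixed edge e with closed neighbourhood N[e] (the edges
-- meeting e, e included), exchanging two edges of N[e] is a bijection of the orderings, so each
-- edge of N[e] comes first among N[e] equally often: e is a seed of at least |E|!/|N[e]|
-- orderings, and |N[e]| ≤ d'(e) + 1.  Cauchy–Schwarz then gives
-- m² · m! ≤ (Σ_B κ(G,B)) · Σ_e |N[e]|, which is the first bound.  For G(n,m) the same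
-- inequality for every m-edge graph, combined by Cauchy–Schwarz once more, leaves the sum of
-- Σ_e |N[e]| over all m-subsets of E(Kₙ): a subset count in which each edge of Kₙ meets
-- 2(n - 2) others.

module Submission where

open import Defs hiding (sym)
open import Data.Bool using (Bool; true; false; T; not; _∧_; _∨_; if_then_else_)
open import Data.Bool.Properties using (∨-zeroʳ; T-≡; T-∨; T-∧)
open import Data.Bool.ListAction using (any; all)
open import Data.Empty using (⊥; ⊥-elim)
open import Data.Fin using (Fin; toℕ)
open import Data.Fin.Properties using (_≟_; toℕ-injective)
open import Data.List using (List; []; _∷_; _++_; map; concat; concatMap; length; filterᵇ; allFin; cartesianProduct)
open import Data.List.Properties
  using (++-assoc; map-++; map-∘; map-cong; map-id-local; concatMap-map; map-concatMap; length-map; length-++; length-tabulate)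
open import Data.List.Membership.Propositional using (_∈_; find)
open import Data.List.Membership.Propositional.Properties
  using (∈-map⁻; ∈-++⁻; ∈-concatMap⁻; ∈-∃++; ∈-allFin; ∈-filter⁺; ∈-filter⁻)
open import Data.List.Relation.Unary.Any using (here; there)
open import Data.List.Relation.Unary.Any.Properties using (any⁻)
open import Data.List.Relation.Unary.All as All using (All; []; _∷_)
open import Data.List.Relation.Unary.All.Properties using (all⁻; ¬All⇒Any¬)
open import Data.List.Relation.Unary.AllPairs using ([]; _∷_)
open import Data.List.Relation.Unary.Unique.Propositional using (Unique)
import Data.List.Relation.Unary.Unique.Propositional.Properties as Unique
open import Data.List.Relation.Binary.Permutation.Propositional
  using (_↭_; ↭-refl; ↭-sym; ↭-trans; ↭-reflexive; ↭⇒↭ₛ; module PermutationReasoning)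
import Data.List.Relation.Binary.Permutation.Propositional as ↭
open import Data.List.Relation.Binary.Permutation.Propositional.Properties
  using (++⁺ˡ; ++⁺; shift; shifts; map⁺; ↭-length; ∈-resp-↭)
import Data.List.Relation.Binary.Permutation.Setoid.Properties as ↭ₛ
open import Data.Nat using (ℕ; zero; suc; _+_; _*_; _∸_; _≤_; _<_; z≤n; s≤s; _<?_; _!)
open import Data.Nat.Properties hiding (_≟_)
open import Data.Nat.Combinatorics using (_C_; nCk+nC[k+1]≡[n+1]C[k+1]; nC1≡n)
open import Data.Nat.ListAction using (sum)
open import Data.Nat.ListAction.Properties using (sum-++; sum-↭)
open import Data.Nat.Tactic.RingSolver using (solve-∀)
open import Data.Product using (∃; _×_; _,_; proj₁; proj₂)
import Data.Product.Properties as Product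
open import Data.Sum using (inj₁; inj₂; [_,_]′)
open import Function using (_∘_; _∘′_)
open import Function.Bundles using (module Equivalence)
open import Relation.Binary.Definitions using (DecidableEquality; tri<; tri≈; tri>)
open import Relation.Binary.PropositionalEquality
open import Relation.Nullary using (yes; no; does; ¬_; contradiction)
open import Relation.Nullary.Decidable using (T?; toWitness; dec-true; dec-false)

private variable A B D : Set

-- Counting and summing over lists

indicator : Bool → ℕ
indicator true  = 1
indicator false = 0

countᵇ : (A → Bool) → List A → ℕ
countᵇ p xs = length (filterᵇ p xs)

countᵇ≡sum-indicator : ∀ (p : A → Bool) xs → countᵇ p xs ≡ sum (map (indicator ∘ p) xs)
countᵇ≡sum-indicator p []       = refl
countᵇ≡sum-indicator p (x ∷ xs) with p x
... | true  = cong suc (countᵇ≡sum-indicator p xs)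
... | false = countᵇ≡sum-indicator p xs

countᵇ-↭ : ∀ (p : A → Bool) {xs ys} → xs ↭ ys → countᵇ p xs ≡ countᵇ p ys
countᵇ-↭ p {xs} {ys} xs↭ys = begin
  countᵇ p xs                  ≡⟨ countᵇ≡sum-indicator p xs ⟩
  sum (map (indicator ∘ p) xs) ≡⟨ sum-↭ (map⁺ (indicator ∘ p) xs↭ys) ⟩
  sum (map (indicator ∘ p) ys) ≡⟨ countᵇ≡sum-indicator p ys ⟨
  countᵇ p ys                  ∎
  where open ≡-Reasoning

countᵇ-cong : ∀ (p q : A → Bool) xs → (∀ {x} → x ∈ xs → p x ≡ q x) → countᵇ p xs ≡ countᵇ q xs
countᵇ-cong p q []       p≗q = refl
countᵇ-cong p q (x ∷ xs) p≗q with p x | q x | p≗q (here refl)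
... | true  | true  | _ = cong suc (countᵇ-cong p q xs (p≗q ∘ there))
... | false | false | _ = countᵇ-cong p q xs (p≗q ∘ there)

countᵇ-∨+countᵇ-∧ : ∀ (p q : A → Bool) xs →
  countᵇ (λ x → p x ∨ q x) xs + countᵇ (λ x → p x ∧ q x) xs ≡ countᵇ p xs + countᵇ q xs
countᵇ-∨+countᵇ-∧ p q []       = refl
countᵇ-∨+countᵇ-∧ p q (x ∷ xs) with p x | q x | countᵇ-∨+countᵇ-∧ p q xs
... | true  | true  | ih = cong suc (trans (+-suc _ _) (trans (cong suc ih) (sym (+-suc _ _))))
... | true  | false | ih = cong suc ih
... | false | true  | ih = trans (cong suc ih) (sym (+-suc _ _))
... | false | false | ih = ih

countᵇ+countᵇ-not : ∀ (p : A → Bool) xs → countᵇ p xs + countᵇ (not ∘ p) xs ≡ length xs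
countᵇ+countᵇ-not p []       = refl
countᵇ+countᵇ-not p (x ∷ xs) with p x
... | true  = cong suc (countᵇ+countᵇ-not p xs)
... | false = trans (+-suc _ _) (cong suc (countᵇ+countᵇ-not p xs))

countᵇ-++ : ∀ (p : A → Bool) xs ys → countᵇ p (xs ++ ys) ≡ countᵇ p xs + countᵇ p ys
countᵇ-++ p []       ys = refl
countᵇ-++ p (x ∷ xs) ys with p x
... | true  = cong suc (countᵇ-++ p xs ys)
... | false = countᵇ-++ p xs ys

countᵇ-map : ∀ (p : B → Bool) (f : A → B) xs → countᵇ p (map f xs) ≡ countᵇ (p ∘ f) xs
countᵇ-map p f []       = refl
countᵇ-map p f (x ∷ xs) with p (f x)
... | true  = cong suc (countᵇ-map p f xs)
... | false = countᵇ-map p f xs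

countᵇ-pos : ∀ (p : A → Bool) {x} xs → x ∈ xs → p x ≡ true → 1 ≤ countᵇ p xs
countᵇ-pos p (y ∷ xs) (here refl) px rewrite px = s≤s z≤n
countᵇ-pos p (y ∷ xs) (there x∈)  px with p y
... | true  = s≤s z≤n
... | false = countᵇ-pos p xs x∈ px

sum-map-+ : ∀ (f g : A → ℕ) xs → sum (map (λ x → f x + g x) xs) ≡ sum (map f xs) + sum (map g xs)
sum-map-+ f g []       = refl
sum-map-+ f g (x ∷ xs) = trans (cong (f x + g x +_) (sum-map-+ f g xs)) (+-+-interchange (f x) (g x) _ _)
  where +-+-interchange : ∀ a b c d → (a + b) + (c + d) ≡ (a + c) + (b + d)
        +-+-interchange = solve-∀

sum-map-mono : ∀ (f g : A → ℕ) xs → (∀ {x} → x ∈ xs → f x ≤ g x) → sum (map f xs) ≤ sum (map g xs)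
sum-map-mono f g []       f≤g = z≤n
sum-map-mono f g (x ∷ xs) f≤g = +-mono-≤ (f≤g (here refl)) (sum-map-mono f g xs (f≤g ∘ there))

sum-map-const : ∀ (f : A → ℕ) k xs → (∀ {x} → x ∈ xs → f x ≡ k) → sum (map f xs) ≡ length xs * k
sum-map-const f k []       f≡k = refl
sum-map-const f k (x ∷ xs) f≡k = cong₂ _+_ (f≡k (here refl)) (sum-map-const f k xs (f≡k ∘ there))

sum-map-swap : ∀ (f : A → B → ℕ) xs ys →
  sum (map (λ y → sum (map (λ x → f x y) xs)) ys) ≡ sum (map (λ x → sum (map (f x) ys)) xs)
sum-map-swap f []       ys = trans (sum-map-const (λ _ → 0) 0 ys (λ _ → refl)) (*-zeroʳ (length ys))
sum-map-swap f (x ∷ xs) ys =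
  trans (sum-map-+ (f x) (λ y → sum (map (λ x → f x y) xs)) ys) (cong (sum (map (f x) ys) +_) (sum-map-swap f xs ys))

remove-∈ : ∀ {y : A} {ys} → y ∈ ys →
  ∃ λ ys' → length ys ≡ suc (length ys') × (∀ {z} → z ∈ ys → z ≢ y → z ∈ ys')
remove-∈ {ys = _ ∷ ys} (here refl) = ys , refl , λ { (here refl) z≢y → ⊥-elim (z≢y refl) ; (there z∈) _ → z∈ }
remove-∈ {ys = w ∷ ys} (there y∈) with ys' , eq , keep ← remove-∈ y∈ =
  w ∷ ys' , cong suc eq , λ { (here refl) _ → here refl ; (there z∈) z≢y → there (keep z∈ z≢y) }

length-≤-by-injection : ∀ (R : A → B → Set) (xs : List A) (ys : List B) → Unique xs →
  (∀ {x} → x ∈ xs → ∃ λ y → y ∈ ys × R x y) → (∀ {x x' y} → R x y → R x' y → x ≡ x') →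
  length xs ≤ length ys
length-≤-by-injection R []       ys _            image inj = z≤n
length-≤-by-injection R (x ∷ xs) ys (x∉xs ∷ uxs) image inj
  with y , y∈ys , Rxy ← image (here refl)
  with ys' , |ys|≡1+|ys'| , keep ← remove-∈ y∈ys =
  subst (suc (length xs) ≤_) (sym |ys|≡1+|ys'|) (s≤s (length-≤-by-injection R xs ys' uxs image' inj))
  where
  image' : ∀ {x'} → x' ∈ xs → ∃ λ y' → y' ∈ ys' × R x' y'
  image' x'∈ with y' , y'∈ , Rx'y' ← image (there x'∈) =
    y' , keep y'∈ (λ { refl → All.lookup x∉xs x'∈ (inj Rxy Rx'y') }) , Rx'y'

four-*-≤-square : ∀ u v → 4 * (u * v) ≤ (u + v) * (u + v)
four-*-≤-square u v = [ ordered u v , swapped ]′ (≤-total u v)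
  where
  ordered : ∀ u v → u ≤ v → 4 * (u * v) ≤ (u + v) * (u + v)
  ordered u v u≤v with d , refl ← m≤n⇒∃[o]m+o≡n u≤v = subst (4 * (u * (u + d)) ≤_) (sym (square u d)) (m≤m+n _ (d * d))
    where square : ∀ u d → (u + (u + d)) * (u + (u + d)) ≡ 4 * (u * (u + d)) + d * d
          square = solve-∀
  swapped : v ≤ u → 4 * (u * v) ≤ (u + v) * (u + v)
  swapped v≤u = subst₂ _≤_ (cong (4 *_) (*-comm v u)) (cong (λ s → s * s) (+-comm v u)) (ordered v u v≤u)

amgm : ∀ u v K → K * K ≤ u * v → 2 * K ≤ u + v
amgm u v K K²≤uv = ≮⇒≥ λ u+v<2K → <⇒≱ (*-mono-< u+v<2K u+v<2K) (begin
  2 * K * (2 * K)   ≡⟨ double² K ⟩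
  4 * (K * K)       ≤⟨ *-monoʳ-≤ 4 K²≤uv ⟩
  4 * (u * v)       ≤⟨ four-*-≤-square u v ⟩
  (u + v) * (u + v) ∎)
  where
  open ≤-Reasoning
  double² : ∀ K → 2 * K * (2 * K) ≡ 4 * (K * K)
  double² = solve-∀

-- Cauchy–Schwarz, via AM–GM on each cross term a x * c y + c x * a y.
module _ (a c : A → ℕ) (K : ℕ) where

  private
    Σa Σc : List A → ℕ
    Σa I = sum (map a I)
    Σc I = sum (map c I)

    cross-terms : ∀ x I → K ≤ a x * c x → (∀ {y} → y ∈ I → K ≤ a y * c y) →
      2 * length I * K ≤ a x * Σc I + c x * Σa I
    cross-terms x []      _  _  = ≤-reflexive (zeros (a x) (c x) K)
      where zeros : ∀ p q K → 2 * 0 * K ≡ p * 0 + q * 0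
            zeros = solve-∀
    cross-terms x (y ∷ I) hx hI =
      ≤-trans (≤-reflexive (split (length I) K))
        (≤-trans (+-mono-≤ pair (cross-terms x I hx (hI ∘ there)))
          (≤-reflexive (collect (a x) (c x) (a y) (c y) (Σc I) (Σa I))))
      where
      split : ∀ t K → 2 * suc t * K ≡ 2 * K + 2 * t * K
      split = solve-∀
      collect : ∀ ax cx ay cy S T → (ax * cy + cx * ay) + (ax * S + cx * T) ≡ ax * (cy + S) + cx * (ay + T)
      collect = solve-∀
      regroup : ∀ ax cx ay cy → (ax * cx) * (ay * cy) ≡ (ax * cy) * (cx * ay)
      regroup = solve-∀
      pair : 2 * K ≤ a x * c y + c x * a y
      pair = amgm (a x * c y) (c x * a y) K
        (≤-trans (*-mono-≤ hx (hI (here refl))) (≤-reflexive (regroup (a x) (c x) (a y) (c y))))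

  length²*≤sum*sum : ∀ I → (∀ {x} → x ∈ I → K ≤ a x * c x) → length I * length I * K ≤ Σa I * Σc I
  length²*≤sum*sum []      _  = z≤n
  length²*≤sum*sum (x ∷ I) hI =
    ≤-trans (≤-reflexive (expand (length I) K))
      (≤-trans (+-mono-≤ (length²*≤sum*sum I (hI ∘ there)) (+-mono-≤ (cross-terms x I (hI (here refl)) (hI ∘ there)) (hI (here refl))))
        (≤-reflexive (collect (a x) (c x) (Σa I) (Σc I))))
    where
    expand : ∀ t K → suc t * suc t * K ≡ t * t * K + (2 * t * K + K)
    expand = solve-∀
    collect : ∀ ax cx S T → S * T + ((ax * T + cx * S) + ax * cx) ≡ (ax + S) * (cx + T)
    collect = solve-∀

sum-map-countᵇ-swap : ∀ (r : A → B → Bool) xs ys →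
  sum (map (λ y → countᵇ (λ x → r x y) xs) ys) ≡ sum (map (λ x → countᵇ (r x) ys) xs)
sum-map-countᵇ-swap r xs ys = begin
  sum (map (λ y → countᵇ (λ x → r x y) xs) ys)                 ≡⟨ cong sum (map-cong (λ y → countᵇ≡sum-indicator (λ x → r x y) xs) ys) ⟩
  sum (map (λ y → sum (map (λ x → indicator (r x y)) xs)) ys) ≡⟨ sum-map-swap (λ x y → indicator (r x y)) xs ys ⟩
  sum (map (λ x → sum (map (indicator ∘ r x) ys)) xs)         ≡⟨ cong sum (map-cong (λ x → countᵇ≡sum-indicator (r x) ys) xs) ⟨
  sum (map (λ x → countᵇ (r x) ys) xs)                         ∎
  where open ≡-Reasoning

countᵇ-cartesianProduct : ∀ (p : A × B → Bool) xs ys →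
  countᵇ p (cartesianProduct xs ys) ≡ sum (map (λ x → countᵇ (λ y → p (x , y)) ys) xs)
countᵇ-cartesianProduct p []       ys = refl
countᵇ-cartesianProduct p (x ∷ xs) ys =
  trans (countᵇ-++ p (map (x ,_) ys) _) (cong₂ _+_ (countᵇ-map p (x ,_) ys) (countᵇ-cartesianProduct p xs ys))

countᵇ-trichotomy : ∀ (p q r : A → Bool) xs → (∀ x → indicator (p x) + indicator (q x) + indicator (r x) ≡ 1) →
  countᵇ p xs + countᵇ q xs + countᵇ r xs ≡ length xs
countᵇ-trichotomy p q r xs exactly-one = begin
  countᵇ p xs + countᵇ q xs + countᵇ r xs
    ≡⟨ cong₂ (λ a b → a + b + countᵇ r xs) (countᵇ≡sum-indicator p xs) (countᵇ≡sum-indicator q xs) ⟩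
  sum (map (indicator ∘ p) xs) + sum (map (indicator ∘ q) xs) + countᵇ r xs
    ≡⟨ cong₂ _+_ (sum-map-+ (indicator ∘ p) (indicator ∘ q) xs) (sym (countᵇ≡sum-indicator r xs)) ⟨
  sum (map (λ x → indicator (p x) + indicator (q x)) xs) + sum (map (indicator ∘ r) xs)
    ≡⟨ sum-map-+ (λ x → indicator (p x) + indicator (q x)) (indicator ∘ r) xs ⟨
  sum (map (λ x → indicator (p x) + indicator (q x) + indicator (r x)) xs)
    ≡⟨ sum-map-const _ 1 xs (λ {x} _ → exactly-one x) ⟩
  length xs * 1
    ≡⟨ *-identityʳ (length xs) ⟩
  length xs ∎
  where open ≡-Reasoning

-- Permutations

Unique-resp-↭ : {xs ys : List A} → xs ↭ ys → Unique xs → Unique ys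
Unique-resp-↭ {A = A} xs↭ys = ↭ₛ.Unique-resp-↭ (setoid A) (↭⇒↭ₛ xs↭ys)

concatMap-++ : ∀ (f : A → List B) xs ys → concatMap f (xs ++ ys) ≡ concatMap f xs ++ concatMap f ys
concatMap-++ f []       ys = refl
concatMap-++ f (x ∷ xs) ys = trans (cong (f x ++_) (concatMap-++ f xs ys)) (sym (++-assoc (f x) _ _))

concatMap-concatMap : ∀ (f : B → List D) (g : A → List B) xs →
  concatMap f (concatMap g xs) ≡ concatMap (λ x → concatMap f (g x)) xs
concatMap-concatMap f g []       = refl
concatMap-concatMap f g (x ∷ xs) =
  trans (concatMap-++ f (g x) _) (cong (concatMap f (g x) ++_) (concatMap-concatMap f g xs))

concatMap-↭ : ∀ (f : A → List B) {xs ys} → xs ↭ ys → concatMap f xs ↭ concatMap f ys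
concatMap-↭ f ↭.refl         = ↭-refl
concatMap-↭ f (↭.prep x p)   = ++⁺ˡ (f x) (concatMap-↭ f p)
concatMap-↭ f (↭.swap x y p) = ↭-trans (shifts (f x) (f y)) (++⁺ˡ (f y) (++⁺ˡ (f x) (concatMap-↭ f p)))
concatMap-↭ f (↭.trans p q)  = ↭-trans (concatMap-↭ f p) (concatMap-↭ f q)

concatMap-cong-↭ : ∀ (f g : A → List B) xs → (∀ x → f x ↭ g x) → concatMap f xs ↭ concatMap g xs
concatMap-cong-↭ f g []       f↭g = ↭-refl
concatMap-cong-↭ f g (x ∷ xs) f↭g = ++⁺ (f↭g x) (concatMap-cong-↭ f g xs f↭g)

concatMap-∷-↭ : ∀ (f : A → B) (g : A → List B) xs →
  concatMap (λ x → f x ∷ g x) xs ↭ map f xs ++ concatMap g xs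
concatMap-∷-↭ f g []       = ↭-refl
concatMap-∷-↭ f g (x ∷ xs) =
  ↭.prep (f x) (↭-trans (++⁺ˡ (g x) (concatMap-∷-↭ f g xs)) (shifts (g x) (map f xs)))

insertions-map : ∀ (f : A → B) x ys → insertions (f x) (map f ys) ≡ map (map f) (insertions x ys)
insertions-map f x []       = refl
insertions-map f x (y ∷ ys) = cong ((f x ∷ f y ∷ map f ys) ∷_) (begin
  map (f y ∷_) (insertions (f x) (map f ys))   ≡⟨ cong (map (f y ∷_)) (insertions-map f x ys) ⟩
  map (f y ∷_) (map (map f) (insertions x ys)) ≡⟨ map-∘ (insertions x ys) ⟨
  map (map f ∘′ (y ∷_)) (insertions x ys)       ≡⟨ map-∘ (insertions x ys) ⟩
  map (map f) (map (y ∷_) (insertions x ys))   ∎)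
  where open ≡-Reasoning

perms-map : ∀ (f : A → B) xs → perms (map f xs) ≡ map (map f) (perms xs)
perms-map f []       = refl
perms-map f (x ∷ xs) = begin
  concatMap (insertions (f x)) (perms (map f xs))                 ≡⟨ cong (concatMap (insertions (f x))) (perms-map f xs) ⟩
  concatMap (insertions (f x)) (map (map f) (perms xs))           ≡⟨ concatMap-map (insertions (f x)) (map f) (perms xs) ⟩
  concatMap (insertions (f x) ∘′ map f) (perms xs)                 ≡⟨ cong concat (map-cong (insertions-map f x) (perms xs)) ⟩
  concatMap (map (map f) ∘′ insertions x) (perms xs)               ≡⟨ map-concatMap (map f) (insertions x) (perms xs) ⟨
  map (map f) (concatMap (insertions x) (perms xs))               ∎
  where open ≡-Reasoning

insertions-comm : ∀ {A : Set} (x y : A) zs →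
  concatMap (insertions x) (insertions y zs) ↭ concatMap (insertions y) (insertions x zs)
insertions-comm x y []       = ↭.swap _ _ ↭-refl
insertions-comm {A} x y (z ∷ zs) = ↭-trans (expand x y) (↭-trans middle (↭-sym (expand y x)))
  where
  rest : A → A → List (List A)
  rest a b = map (z ∷_) (concatMap (insertions a) (insertions b zs))
  expand : ∀ a b → concatMap (insertions a) (insertions b (z ∷ zs)) ↭
    (a ∷ b ∷ z ∷ zs) ∷ (b ∷ a ∷ z ∷ zs) ∷
      (map (λ Q → b ∷ z ∷ Q) (insertions a zs) ++ (map (λ Q → a ∷ z ∷ Q) (insertions b zs) ++ rest a b))
  expand a b = ↭.prep _ (↭.prep _ (++⁺ (↭-reflexive (sym (map-∘ (insertions a zs))))
    (↭-trans (↭-reflexive (concatMap-map (insertions a) (z ∷_) (insertions b zs)))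
      (↭-trans (concatMap-∷-↭ (λ Q → a ∷ z ∷ Q) (map (z ∷_) ∘′ insertions a) (insertions b zs))
        (++⁺ˡ _ (↭-reflexive (sym (map-concatMap (z ∷_) (insertions a) (insertions b zs)))))))))
  middle : (x ∷ y ∷ z ∷ zs) ∷ (y ∷ x ∷ z ∷ zs) ∷
             (map (λ Q → y ∷ z ∷ Q) (insertions x zs) ++ (map (λ Q → x ∷ z ∷ Q) (insertions y zs) ++ rest x y))
         ↭ (y ∷ x ∷ z ∷ zs) ∷ (x ∷ y ∷ z ∷ zs) ∷
             (map (λ Q → x ∷ z ∷ Q) (insertions y zs) ++ (map (λ Q → y ∷ z ∷ Q) (insertions x zs) ++ rest y x))
  middle = ↭.swap _ _ (↭-trans (shifts (map (λ Q → y ∷ z ∷ Q) (insertions x zs)) (map (λ Q → x ∷ z ∷ Q) (insertions y zs)))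
    (++⁺ˡ (map (λ Q → x ∷ z ∷ Q) (insertions y zs)) (++⁺ˡ (map (λ Q → y ∷ z ∷ Q) (insertions x zs)) (map⁺ (z ∷_) (insertions-comm x y zs)))))

perms-↭ : {xs ys : List A} → xs ↭ ys → perms xs ↭ perms ys
perms-↭ ↭.refl        = ↭-refl
perms-↭ (↭.prep x p)  = concatMap-↭ (insertions x) (perms-↭ p)
perms-↭ {xs = x ∷ y ∷ xs} {ys = _ ∷ _ ∷ ys} (↭.swap _ _ p) = begin
  concatMap (insertions x) (concatMap (insertions y) (perms xs)) ↭⟨ concatMap-↭ (insertions x) (concatMap-↭ (insertions y) (perms-↭ p)) ⟩
  concatMap (insertions x) (concatMap (insertions y) (perms ys)) ≡⟨ concatMap-concatMap (insertions x) (insertions y) (perms ys) ⟩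
  concatMap (λ P → concatMap (insertions x) (insertions y P)) (perms ys) ↭⟨ concatMap-cong-↭ _ _ (perms ys) (insertions-comm x y) ⟩
  concatMap (λ P → concatMap (insertions y) (insertions x P)) (perms ys) ≡⟨ concatMap-concatMap (insertions y) (insertions x) (perms ys) ⟨
  concatMap (insertions y) (concatMap (insertions x) (perms ys)) ∎
  where open PermutationReasoning
perms-↭ (↭.trans p q) = ↭-trans (perms-↭ p) (perms-↭ q)

∈-insertions⇒↭ : ∀ (x : A) ys {zs} → zs ∈ insertions x ys → zs ↭ x ∷ ys
∈-insertions⇒↭ x []       (here refl) = ↭-refl
∈-insertions⇒↭ x (y ∷ ys) (here refl) = ↭-refl
∈-insertions⇒↭ x (y ∷ ys) (there zs∈) with zs' , zs'∈ , refl ← ∈-map⁻ (y ∷_) zs∈ =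
  ↭-trans (↭.prep y (∈-insertions⇒↭ x ys zs'∈)) (↭.swap y x ↭-refl)

∈-perms⇒↭ : ∀ (xs : List A) {ys} → ys ∈ perms xs → ys ↭ xs
∈-perms⇒↭ []       (here refl) = ↭-refl
∈-perms⇒↭ (x ∷ xs) ys∈ with zs , zs∈ , ys∈' ← find (∈-concatMap⁻ (insertions x) ys∈) =
  ↭-trans (∈-insertions⇒↭ x zs ys∈') (↭.prep x (∈-perms⇒↭ xs zs∈))

length-insertions : ∀ (x : A) ys → length (insertions x ys) ≡ suc (length ys)
length-insertions x []       = refl
length-insertions x (y ∷ ys) = cong suc (trans (length-map (y ∷_) (insertions x ys)) (length-insertions x ys))

length-concatMap : ∀ (f : A → List B) xs → length (concatMap f xs) ≡ sum (map (length ∘′ f) xs)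
length-concatMap f []       = refl
length-concatMap f (x ∷ xs) = trans (length-++ (f x)) (cong (length (f x) +_) (length-concatMap f xs))

length-perms : ∀ (xs : List A) → length (perms xs) ≡ length xs !
length-perms []       = refl
length-perms (x ∷ xs) = begin
  length (concatMap (insertions x) (perms xs))         ≡⟨ length-concatMap (insertions x) (perms xs) ⟩
  sum (map (length ∘′ insertions x) (perms xs))        ≡⟨ sum-map-const _ (suc (length xs)) (perms xs) length-insertion ⟩
  length (perms xs) * suc (length xs)                  ≡⟨ cong (_* suc (length xs)) (length-perms xs) ⟩
  length xs ! * suc (length xs)                        ≡⟨ *-comm (length xs !) (suc (length xs)) ⟩
  suc (length xs) * length xs !                        ∎
  where
  open ≡-Reasoning
  length-insertion : ∀ {ys} → ys ∈ perms xs → length (insertions x ys) ≡ suc (length xs)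
  length-insertion {ys} ys∈ = trans (length-insertions x ys) (cong suc (↭-length (∈-perms⇒↭ xs ys∈)))

∈-∈⇒↭-∷-∷ : ∀ {e f : A} {xs} → e ≢ f → e ∈ xs → f ∈ xs → ∃ λ R → xs ↭ e ∷ f ∷ R
∈-∈⇒↭-∷-∷ {e = e} {f} e≢f e∈ f∈ with ys , zs , refl ← ∈-∃++ e∈ with ∈-resp-↭ (shift e ys zs) f∈
... | here f≡e  = ⊥-elim (e≢f (sym f≡e))
... | there f∈' with ys' , zs' , ys++zs≡ ← ∈-∃++ f∈' =
  ys' ++ zs' , ↭-trans (shift e ys zs) (↭.prep e (↭-trans (↭-reflexive ys++zs≡) (shift f ys' zs')))

-- The first element of an ordering satisfying a predicate

module _ {A : Set} (_≟_ : DecidableEquality A) where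

  _=ᵇ_ : A → A → Bool
  x =ᵇ y = does (x ≟ y)

  =ᵇ-refl : ∀ x → (x =ᵇ x) ≡ true
  =ᵇ-refl x = dec-true (x ≟ x) refl

  ≢⇒=ᵇ-false : ∀ {x y} → x ≢ y → (x =ᵇ y) ≡ false
  ≢⇒=ᵇ-false {x} {y} = dec-false (x ≟ y)

  =ᵇ⇒≡ : ∀ x y → (x =ᵇ y) ≡ true → x ≡ y
  =ᵇ⇒≡ x y x=ᵇy with x ≟ y
  ... | yes x≡y = x≡y

  firstᵇ : (A → Bool) → A → List A → Bool
  firstᵇ p x []       = false
  firstᵇ p x (y ∷ ys) = if p y then y =ᵇ x else firstᵇ p x ys

  firstᵇ⇒∈ : ∀ p x ys → firstᵇ p x ys ≡ true → x ∈ ys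
  firstᵇ⇒∈ p x (y ∷ ys) first with p y
  ... | true  = here (sym (=ᵇ⇒≡ y x first))
  ... | false = there (firstᵇ⇒∈ p x ys first)

  ∃-firstᵇ : ∀ p {x} ys → x ∈ ys → p x ≡ true → ∃ λ z → z ∈ ys × p z ≡ true × firstᵇ p z ys ≡ true
  ∃-firstᵇ p (y ∷ ys) (here refl) px = y , here refl , px , first
    where first : firstᵇ p y (y ∷ ys) ≡ true
          first rewrite px = =ᵇ-refl y
  ∃-firstᵇ p (y ∷ ys) (there x∈)  px with p y in py
  ... | true  = y , here refl , py , =ᵇ-refl y
  ... | false with z , z∈ , pz , first ← ∃-firstᵇ p ys x∈ px = z , there z∈ , pz , first

  transpose : A → A → A → A
  transpose e f x = if x =ᵇ e then f else if x =ᵇ f then e else x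

  module _ {e f : A} (e≢f : e ≢ f) where

    transpose-e : transpose e f e ≡ f
    transpose-e rewrite =ᵇ-refl e = refl

    transpose-f : transpose e f f ≡ e
    transpose-f rewrite ≢⇒=ᵇ-false (e≢f ∘ sym) | =ᵇ-refl f = refl

    transpose-other : ∀ {x} → x ≢ e → x ≢ f → transpose e f x ≡ x
    transpose-other x≢e x≢f rewrite ≢⇒=ᵇ-false x≢e | ≢⇒=ᵇ-false x≢f = refl

    transpose-=ᵇ-e : ∀ x → (transpose e f x =ᵇ e) ≡ (x =ᵇ f)
    transpose-=ᵇ-e x with x ≟ e
    ... | yes refl = trans (≢⇒=ᵇ-false (e≢f ∘ sym)) (sym (≢⇒=ᵇ-false e≢f))
    ... | no x≢e with x ≟ f
    ...   | yes refl = =ᵇ-refl e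
    ...   | no x≢f   = ≢⇒=ᵇ-false x≢e

    module _ (p : A → Bool) (pe : p e ≡ true) (pf : p f ≡ true) where

      p-transpose : ∀ x → p (transpose e f x) ≡ p x
      p-transpose x with x ≟ e
      ... | yes refl = trans pf (sym pe)
      ... | no x≢e with x ≟ f
      ...   | yes refl = trans pe (sym pf)
      ...   | no x≢f   = refl

      firstᵇ-map-transpose : ∀ ys → firstᵇ p e (map (transpose e f) ys) ≡ firstᵇ p f ys
      firstᵇ-map-transpose []       = refl
      firstᵇ-map-transpose (y ∷ ys) rewrite p-transpose y with p y
      ... | true  = transpose-=ᵇ-e y
      ... | false = firstᵇ-map-transpose ys

    map-transpose-↭ : ∀ xs → Unique xs → e ∈ xs → f ∈ xs → map (transpose e f) xs ↭ xs
    map-transpose-↭ xs uxs e∈ f∈ with R , xs↭efR ← ∈-∈⇒↭-∷-∷ e≢f e∈ f∈ =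
      ↭-trans (map⁺ (transpose e f) xs↭efR) (↭-trans (↭-reflexive swapped) (↭-trans (↭.swap f e ↭-refl) (↭-sym xs↭efR)))
      where
      fixes-R : All (λ x → transpose e f x ≡ x) R
      fixes-R with (_ All.∷ e∉R) ∷ f∉R ∷ _ ← Unique-resp-↭ xs↭efR uxs =
        All.tabulate λ x∈ → transpose-other (λ { refl → All.lookup e∉R x∈ refl }) (λ { refl → All.lookup f∉R x∈ refl })
      swapped : map (transpose e f) (e ∷ f ∷ R) ≡ f ∷ e ∷ R
      swapped rewrite transpose-e | transpose-f | map-id-local fixes-R = refl

  module _ {E : List A} (uE : Unique E) (p : A → Bool) where

    countᵇ-firstᵇ-perms : ∀ {e f} → e ∈ E → f ∈ E → p e ≡ true → p f ≡ true →
      countᵇ (firstᵇ p f) (perms E) ≡ countᵇ (firstᵇ p e) (perms E)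
    countᵇ-firstᵇ-perms {e} {f} e∈ f∈ pe pf with e ≟ f
    ... | yes refl = refl
    ... | no e≢f = begin
      countᵇ (firstᵇ p f) (perms E)                         ≡⟨ countᵇ-cong _ _ (perms E) (λ {B} _ → sym (firstᵇ-map-transpose e≢f p pe pf B)) ⟩
      countᵇ (firstᵇ p e ∘ map τ) (perms E)                 ≡⟨ countᵇ-map (firstᵇ p e) (map τ) (perms E) ⟨
      countᵇ (firstᵇ p e) (map (map τ) (perms E))           ≡⟨ cong (countᵇ (firstᵇ p e)) (perms-map τ E) ⟨
      countᵇ (firstᵇ p e) (perms (map τ E))                 ≡⟨ countᵇ-↭ (firstᵇ p e) (perms-↭ (map-transpose-↭ e≢f E uE e∈ f∈)) ⟩
      countᵇ (firstᵇ p e) (perms E)                         ∎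
      where
      open ≡-Reasoning
      τ = transpose e f

    length-perms-≤ : ∀ {e} → e ∈ E → p e ≡ true →
      length (perms E) ≤ countᵇ (firstᵇ p e) (perms E) * countᵇ p E
    length-perms-≤ {e} e∈ pe = begin
      length (perms E)                                        ≡⟨ *-identityʳ (length (perms E)) ⟨
      length (perms E) * 1                                    ≡⟨ sum-map-const (λ _ → 1) 1 (perms E) (λ _ → refl) ⟨
      sum (map (λ _ → 1) (perms E))                           ≤⟨ sum-map-mono _ _ (perms E) has-first ⟩
      sum (map (λ B → countᵇ (λ f → firstᵇ p f B) N) (perms E)) ≡⟨ sum-map-countᵇ-swap (firstᵇ p) N (perms E) ⟩
      sum (map (λ f → countᵇ (firstᵇ p f) (perms E)) N)       ≡⟨ sum-map-const _ _ N (λ f∈N → countᵇ-firstᵇ-perms e∈ (∈N⇒∈E f∈N) pe (∈N⇒p f∈N)) ⟩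
      length N * countᵇ (firstᵇ p e) (perms E)                ≡⟨ *-comm (length N) _ ⟩
      countᵇ (firstᵇ p e) (perms E) * countᵇ p E              ∎
      where
      open ≤-Reasoning
      N = filterᵇ p E
      ∈N⇒∈E : ∀ {f} → f ∈ N → f ∈ E
      ∈N⇒∈E f∈N = proj₁ (∈-filter⁻ (T? ∘ p) {xs = E} f∈N)
      ∈N⇒p : ∀ {f} → f ∈ N → p f ≡ true
      ∈N⇒p f∈N = Equivalence.to T-≡ (proj₂ (∈-filter⁻ (T? ∘ p) {xs = E} f∈N))
      has-first : ∀ {B} → B ∈ perms E → 1 ≤ countᵇ (λ f → firstᵇ p f B) N
      has-first {B} B∈ with z , z∈B , pz , first ← ∃-firstᵇ p B (∈-resp-↭ (↭-sym (∈-perms⇒↭ E B∈)) e∈) pe =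
        countᵇ-pos (λ f → firstᵇ p f B) N (∈-filter⁺ (T? ∘ p) (∈-resp-↭ (∈-perms⇒↭ E B∈) z∈B) (Equivalence.from T-≡ pz)) first

-- The forest building process

∨≡false : ∀ a b → a ∨ b ≡ false → a ≡ false × b ≡ false
∨≡false false false refl = refl , refl

module _ {n : ℕ} where

  _≟ᴱ_ : DecidableEquality (Edge n)
  _≟ᴱ_ = Product.≡-dec _≟_ _≟_

  ==-refl : (u : Fin n) → (u == u) ≡ true
  ==-refl u with u ≟ u
  ... | yes _   = refl
  ... | no u≢u = ⊥-elim (u≢u refl)

  ==⇒≡ : (u v : Fin n) → (u == v) ≡ true → u ≡ v
  ==⇒≡ u v u==v with u ≟ v
  ... | yes u≡v = u≡v

  ≢⇒==-false : ∀ {i j : Fin n} → i ≢ j → (i == j) ≡ false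
  ≢⇒==-false {i} {j} i≢j with i ≟ j
  ... | yes i≡j = contradiction i≡j i≢j
  ... | no _    = refl

  incident-proj₁ : (e : Edge n) → incident (proj₁ e) e ≡ true
  incident-proj₁ (u , v) rewrite ==-refl u = refl

  incident-proj₂ : (e : Edge n) → incident (proj₂ e) e ≡ true
  incident-proj₂ (u , v) rewrite ==-refl v = ∨-zeroʳ (v == u)

  meets : Edge n → Edge n → Bool
  meets e f = incident (proj₁ e) f ∨ incident (proj₂ e) f

  meets-refl : (e : Edge n) → meets e e ≡ true
  meets-refl e rewrite incident-proj₁ e = refl

  -- Seeds are kept by the process, and each one starts a new tree of the forest.
  isSeed : List (Edge n) → Edge n → Bool
  isSeed B e = firstᵇ _≟ᴱ_ (meets e) e B

  touched-∷ : ∀ e seen (w : Fin n) → touched seen w ≡ true → touched (e ∷ seen) w ≡ true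
  touched-∷ e seen w t = trans (cong (incident w e ∨_) t) (∨-zeroʳ _)

  touched-here : ∀ e seen (w : Fin n) → incident w e ≡ true → touched (e ∷ seen) w ≡ true
  touched-here e seen w i = cong (_∨ touched seen w) i

  ∈⇒touched : ∀ {e} B (w : Fin n) → e ∈ B → incident w e ≡ true → touched B w ≡ true
  ∈⇒touched (e ∷ B) w (here refl) i = touched-here e B w i
  ∈⇒touched (f ∷ B) w (there e∈) i = touched-∷ f B w (∈⇒touched B w e∈ i)

  ¬meets⇒untouched : ∀ e seen → any (meets e) seen ≡ false →
    touched seen (proj₁ e) ≡ false × touched seen (proj₂ e) ≡ false
  ¬meets⇒untouched e []         _ = refl , refl
  ¬meets⇒untouched e (f ∷ seen) ¬meets
    with ¬meets-f , ¬meets-seen ← ∨≡false (meets e f) (any (meets e) seen) ¬meets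
    with ¬i₁ , ¬i₂ ← ∨≡false (incident (proj₁ e) f) (incident (proj₂ e) f) ¬meets-f
    with t₁ , t₂ ← ¬meets⇒untouched e seen ¬meets-seen = cong₂ _∨_ ¬i₁ t₁ , cong₂ _∨_ ¬i₂ t₂

  -- Starting from the identity, every tree of the forest ends up labelled by the first
  -- endpoint of its first edge.
  relabel : List (Edge n) → Edge n → (Fin n → Fin n) → Fin n → Fin n
  relabel seen (u , v) L w =
    if not (touched seen w) ∧ incident w (u , v) then (if touched seen v then L v else L u) else L w

  labels : List (Edge n) → List (Edge n) → (Fin n → Fin n) → Fin n → Fin n
  labels seen []       L = L
  labels seen (e ∷ es) L = labels (e ∷ seen) es (relabel seen e L)

  FixesUntouched : (Fin n → Fin n) → List (Edge n) → Set
  FixesUntouched L seen = ∀ w → touched seen w ≡ false → L w ≡ w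

  relabel-touched : ∀ seen e L (w : Fin n) → touched seen w ≡ true → relabel seen e L w ≡ L w
  relabel-touched seen (u , v) L w t rewrite t = refl

  relabel-fixesUntouched : ∀ L seen e → FixesUntouched L seen → FixesUntouched (relabel seen e L) (e ∷ seen)
  relabel-fixesUntouched L seen (u , v) fixes w t
    with ¬i , ¬t ← ∨≡false (incident w (u , v)) (touched seen w) t rewrite ¬i | ¬t = fixes w ¬t

  labels-touched : ∀ seen es L (w : Fin n) → touched seen w ≡ true → labels seen es L w ≡ L w
  labels-touched seen []       L w t = refl
  labels-touched seen (e ∷ es) L w t =
    trans (labels-touched (e ∷ seen) es (relabel seen e L) w (touched-∷ e seen w t)) (relabel-touched seen e L w t)

  labels-untouched : ∀ seen es L (w : Fin n) → FixesUntouched L seen →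
    touched seen w ≡ false → touched es w ≡ false → labels seen es L w ≡ w
  labels-untouched seen []       L w fixes t _  = fixes w t
  labels-untouched seen (e ∷ es) L w fixes t t'
    with ¬i , ¬t' ← ∨≡false (incident w e) (touched es w) t' =
    labels-untouched (e ∷ seen) es (relabel seen e L) w (relabel-fixesUntouched L seen e fixes) (cong₂ _∨_ ¬i t) ¬t'

  relabel-kept : ∀ seen u v L → (not (touched seen u) ∨ not (touched seen v)) ≡ true →
    relabel seen (u , v) L u ≡ relabel seen (u , v) L v
  relabel-kept seen u v L kept rewrite ==-refl u | ==-refl v | ∨-zeroʳ (v == u)
    with touched seen u | touched seen v
  ... | false | false = refl
  ... | false | true  = refl
  ... | true  | false = refl

  labels-forest : ∀ seen es L {f} → f ∈ buildFrom seen es →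
    labels seen es L (proj₁ f) ≡ labels seen es L (proj₂ f)
  labels-forest seen ((u , v) ∷ es) L f∈ with (not (touched seen u) ∨ not (touched seen v)) in kept
  labels-forest seen ((u , v) ∷ es) L (here refl) | true = begin
    labels (e ∷ seen) es L' u ≡⟨ labels-touched (e ∷ seen) es L' u (touched-here e seen u (incident-proj₁ e)) ⟩
    L' u                      ≡⟨ relabel-kept seen u v L kept ⟩
    L' v                      ≡⟨ labels-touched (e ∷ seen) es L' v (touched-here e seen v (incident-proj₂ e)) ⟨
    labels (e ∷ seen) es L' v ∎
    where
    open ≡-Reasoning
    e = (u , v)
    L' = relabel seen e L
  labels-forest seen ((u , v) ∷ es) L (there f∈) | true  = labels-forest ((u , v) ∷ seen) es (relabel seen (u , v) L) f∈
  labels-forest seen ((u , v) ∷ es) L f∈         | false = labels-forest ((u , v) ∷ seen) es (relabel seen (u , v) L) f∈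

  labels-seed : ∀ seen es L e → FixesUntouched L seen → any (meets e) seen ≡ false →
    firstᵇ _≟ᴱ_ (meets e) e es ≡ true → labels seen es L (proj₁ e) ≡ proj₁ e
  labels-seed seen (f ∷ es) L e fixes ¬meets first with meets e f in e-meets-f
  ... | true with refl ← =ᵇ⇒≡ _≟ᴱ_ f e first =
    trans (labels-touched (f ∷ seen) es (relabel seen f L) (proj₁ f) (touched-here f seen (proj₁ f) (incident-proj₁ f)))
      relabel-seed
    where
    relabel-seed : relabel seen f L (proj₁ f) ≡ proj₁ f
    relabel-seed with t₁ , t₂ ← ¬meets⇒untouched f seen ¬meets rewrite t₁ | t₂ | incident-proj₁ f = fixes (proj₁ f) t₁
  ... | false =
    labels-seed (f ∷ seen) es (relabel seen f L) e (relabel-fixesUntouched L seen f fixes)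
      (trans (cong (_∨ any (meets e) seen) e-meets-f) ¬meets) first

  touched-forest : ∀ seen es (w : Fin n) → touched es w ≡ true → touched seen w ≡ false →
    touched (buildFrom seen es) w ≡ true
  touched-forest seen ((u , v) ∷ es) w t ¬t with incident w (u , v) in w∈e
  ... | true with (not (touched seen u) ∨ not (touched seen v)) in kept
  ...   | true  = cong (_∨ touched (buildFrom ((u , v) ∷ seen) es) w) w∈e
  ...   | false = ⊥-elim (not-kept (w == u) refl w∈e)
    where
    not-kept : ∀ b → (w == u) ≡ b → (b ∨ (w == v)) ≡ true → ⊥
    not-kept true  w==u _    rewrite ==⇒≡ w u w==u | ¬t = contradiction kept λ ()
    not-kept false _    w==v rewrite ==⇒≡ w v w==v | ¬t | ∨-zeroʳ (not (touched seen u)) = contradiction kept λ ()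
  touched-forest seen ((u , v) ∷ es) w t ¬t | false with (not (touched seen u) ∨ not (touched seen v))
  ... | true  = trans (cong (_∨ touched (buildFrom ((u , v) ∷ seen) es) w) w∈e)
                  (touched-forest ((u , v) ∷ seen) es w t (trans (cong (_∨ touched seen w) w∈e) ¬t))
  ... | false = touched-forest ((u , v) ∷ seen) es w t (trans (cong (_∨ touched seen w) w∈e) ¬t)

  meets-of-proj₁ : ∀ (e e' : Edge n) → proj₁ e ≡ proj₁ e' → meets e' e ≡ true
  meets-of-proj₁ (u , v) (.u , v') refl rewrite ==-refl u = refl

  isSeed-proj₁-injective : ∀ B e e' → isSeed B e ≡ true → isSeed B e' ≡ true → proj₁ e ≡ proj₁ e' → e ≡ e'
  isSeed-proj₁-injective (f ∷ B) e e' seed seed' same with meets e f in e-f | meets e' f in e'-f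
  ... | true  | true  = trans (sym (=ᵇ⇒≡ _≟ᴱ_ f e seed)) (=ᵇ⇒≡ _≟ᴱ_ f e' seed')
  ... | true  | false with refl ← =ᵇ⇒≡ _≟ᴱ_ f e seed = contradiction (trans (sym e'-f) (meets-of-proj₁ e e' same)) λ ()
  ... | false | true  with refl ← =ᵇ⇒≡ _≟ᴱ_ f e' seed' = contradiction (trans (sym e-f) (meets-of-proj₁ e' e (sym same))) λ ()
  ... | false | false = isSeed-proj₁-injective B e e' seed seed' same

  walk-label : ∀ (L : Fin n → Fin n) F → (∀ {f} → f ∈ F → L (proj₁ f) ≡ L (proj₂ f)) →
    ∀ k u v → T (walk k F u v) → L u ≡ L v
  walk-label L F const zero    u v w = cong L (toWitness w)
  walk-label L F const (suc k) u v w with Equivalence.to (T-∨ {walk k F u v}) w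
  ... | inj₁ w' = walk-label L F const k u v w'
  ... | inj₂ w' with (a , b) , f∈ , step ← find (any⁻ _ F w')
                with Equivalence.to (T-∨ {u == a ∧ walk k F b v}) step
  ...   | inj₁ s with u≡a , b~v ← Equivalence.to (T-∧ {u == a}) s =
    trans (cong L (toWitness u≡a)) (trans (const f∈) (walk-label L F const k b v b~v))
  ...   | inj₂ s with u≡b , a~v ← Equivalence.to (T-∧ {u == b}) s =
    trans (cong L (toWitness u≡b)) (trans (sym (const f∈)) (walk-label L F const k a v a~v))

  -- κ counts the components with an edge through their least vertices, the roots.
  isRoot : List (Edge n) → Fin n → Bool
  isRoot F w = touched F w ∧ all (λ x → not (x <ᵇ w) ∨ not (connected F w x)) (allFin n)

  ∃-root-labelled : ∀ F (L : Fin n → Fin n) → (∀ {f} → f ∈ F → L (proj₁ f) ≡ L (proj₂ f)) → ∀ ℓ →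
    (∀ x → L x ≡ ℓ → T (touched F x)) → ∀ x → L x ≡ ℓ → ∃ λ w → T (isRoot F w) × L w ≡ ℓ
  ∃-root-labelled F L const ℓ labelled-touched x Lx≡ℓ = descend (suc (toℕ x)) x ≤-refl Lx≡ℓ
    where
    smaller-connected : ∀ a b → ¬ T (not a ∨ not b) → T a × T b
    smaller-connected true true _ = _ , _
    smaller-connected true  false ¬t = ⊥-elim (¬t _)
    smaller-connected false _     ¬t = ⊥-elim (¬t _)
    descend : ∀ k x → toℕ x < k → L x ≡ ℓ → ∃ λ w → T (isRoot F w) × L w ≡ ℓ
    descend (suc k) x (s≤s x≤k) Lx≡ℓ with T? (isRoot F x)
    ... | yes root = x , root , Lx≡ℓ
    ... | no ¬root
      with y , _ , ¬ok ← find (¬All⇒Any¬ (T? ∘ _) (allFin n)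
             (λ all-ok → ¬root (Equivalence.from T-∧ (labelled-touched x Lx≡ℓ , all⁻ _ all-ok))))
      with y<x , x~y ← smaller-connected (y <ᵇ x) (connected F x y) ¬ok =
      descend k y (<-≤-trans (<ᵇ⇒< _ _ y<x) x≤k) (trans (sym (walk-label L F const n x y x~y)) Lx≡ℓ)

  seeds≤κ : ∀ (E B : List (Edge n)) → Unique E → countᵇ (isSeed B) E ≤ κ B
  seeds≤κ E B uE =
    length-≤-by-injection R (filterᵇ (isSeed B) E) (filterᵇ (isRoot F) (allFin n))
      (Unique.filter⁺ (T? ∘ isSeed B) uE) image
      (λ (seed , Lw≡) (seed' , Lw≡') → isSeed-proj₁-injective B _ _ seed seed' (trans (sym Lw≡) Lw≡'))
    where
    F = forest B
    L = labels [] B (λ w → w)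
    R : Edge n → Fin n → Set
    R e w = isSeed B e ≡ true × L w ≡ proj₁ e
    fixes₀ : FixesUntouched (λ w → w) []
    fixes₀ _ _ = refl
    labelled-touched : ∀ e → isSeed B e ≡ true → ∀ x → L x ≡ proj₁ e → T (touched F x)
    labelled-touched e seed x Lx≡ with touched B x in t
    ... | true  = Equivalence.from T-≡ (touched-forest [] B x t refl)
    ... | false = contradiction (trans (sym t) (subst (λ y → touched B y ≡ true) (sym x≡proj₁e) proj₁e-touched)) λ ()
      where
      proj₁e-touched : touched B (proj₁ e) ≡ true
      proj₁e-touched = ∈⇒touched B (proj₁ e) (firstᵇ⇒∈ _≟ᴱ_ (meets e) e B seed) (incident-proj₁ e)
      x≡proj₁e : x ≡ proj₁ e
      x≡proj₁e = trans (sym (labels-untouched [] B (λ w → w) x fixes₀ refl t)) Lx≡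
    image : ∀ {e} → e ∈ filterᵇ (isSeed B) E → ∃ λ w → w ∈ filterᵇ (isRoot F) (allFin n) × R e w
    image {e} e∈ with seed ← Equivalence.to T-≡ (proj₂ (∈-filter⁻ (T? ∘ isSeed B) {xs = E} e∈))
      with w , root , Lw≡ ← ∃-root-labelled F L (labels-forest [] B (λ w → w)) (proj₁ e) (labelled-touched e seed)
                                (proj₁ e) (labels-seed [] B (λ w → w) e fixes₀ refl seed) =
      w , ∈-filter⁺ (T? ∘ isRoot F) (∈-allFin w) root , seed , Lw≡

-- Seeds and the bound for a fixed graph

module _ {n : ℕ} where

  seedCount : List (Edge n) → Edge n → ℕ
  seedCount E e = countᵇ (λ B → isSeed B e) (perms E)

  sum-seedCount≤sumκ : ∀ (E : List (Edge n)) → Unique E → sum (map (seedCount E) E) ≤ sumκ E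
  sum-seedCount≤sumκ E uE = begin
    sum (map (seedCount E) E)                   ≡⟨ sum-map-countᵇ-swap (λ e B → isSeed B e) E (perms E) ⟨
    sum (map (λ B → countᵇ (isSeed B) E) (perms E)) ≤⟨ sum-map-mono _ κ (perms E) (λ {B} _ → seeds≤κ E B uE) ⟩
    sumκ E                                       ∎
    where open ≤-Reasoning

  length-perms-≤-seedCount : ∀ (E : List (Edge n)) → Unique E → ∀ {e} → e ∈ E →
    length (perms E) ≤ seedCount E e * countᵇ (meets e) E
  length-perms-≤-seedCount E uE {e} e∈ = length-perms-≤ _≟ᴱ_ uE (meets e) e∈ (meets-refl e)

  closedNbhdSum : List (Edge n) → ℕ
  closedNbhdSum E = sum (map (λ e → countᵇ (meets e) E) E)

  sumκ-≥ : ∀ (E : List (Edge n)) → Unique E → length E * length E * length (perms E) ≤ sumκ E * closedNbhdSum E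
  sumκ-≥ E uE =
    ≤-trans (length²*≤sum*sum (seedCount E) (λ e → countᵇ (meets e) E) (length (perms E)) E
               (length-perms-≤-seedCount E uE))
            (*-monoˡ-≤ (closedNbhdSum E) (sum-seedCount≤sumκ E uE))

  Ordered : Edge n → Set
  Ordered (a , b) = toℕ a < toℕ b

  opposite : Fin n → Edge n → Fin n
  opposite u (a , b) = if u == a then b else a

  opposite-injective : ∀ u {f f'} → Ordered f → Ordered f' → incident u f ≡ true → incident u f' ≡ true →
    opposite u f ≡ opposite u f' → f ≡ f'
  opposite-injective u {a , b} {a' , b'} a<b a'<b' u∈f u∈f' same with u == a in u=a | u == a' in u=a'
  ... | true  | true  with refl ← ==⇒≡ u a u=a | refl ← ==⇒≡ u a' u=a' = cong (u ,_) same
  ... | true  | false with refl ← ==⇒≡ u a u=a | refl ← ==⇒≡ u b' u∈f' =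
    ⊥-elim (<-asym a<b (subst (λ z → toℕ z < toℕ u) (sym same) a'<b'))
  ... | false | true  with refl ← ==⇒≡ u b u∈f | refl ← ==⇒≡ u a' u=a' =
    ⊥-elim (<-asym a'<b' (subst (λ z → toℕ z < toℕ u) same a<b))
  ... | false | false with refl ← ==⇒≡ u b u∈f | refl ← ==⇒≡ u b' u∈f' = cong (_, u) same

  countᵇ-incident-≤ : ∀ (E : List (Edge n)) u (Q : Fin n → Bool) → Unique E → (∀ {f} → f ∈ E → Ordered f) →
    (∀ {f} → f ∈ E → incident u f ≡ true → Q (opposite u f) ≡ true) →
    countᵇ (incident u) E ≤ countᵇ Q (allFin n)
  countᵇ-incident-≤ E u Q uE ordered Q-opposite =
    length-≤-by-injection R (filterᵇ (incident u) E) (filterᵇ Q (allFin n))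
      (Unique.filter⁺ (T? ∘ incident u) uE) image
      (λ { (f∈ , u∈f , refl) (f'∈ , u∈f' , same) → opposite-injective u (ordered f∈) (ordered f'∈) u∈f u∈f' same })
    where
    R : Edge n → Fin n → Set
    R f w = f ∈ E × incident u f ≡ true × w ≡ opposite u f
    image : ∀ {f} → f ∈ filterᵇ (incident u) E → ∃ λ w → w ∈ filterᵇ Q (allFin n) × R f w
    image {f} f∈ with f∈E , u∈f ← ∈-filter⁻ (T? ∘ incident u) {xs = E} f∈ =
      opposite u f ,
      ∈-filter⁺ (T? ∘ Q) (∈-allFin _) (Equivalence.from T-≡ (Q-opposite f∈E (Equivalence.to T-≡ u∈f))) ,
      f∈E , Equivalence.to T-≡ u∈f , refl

  countᵇ-meets+1≤ : ∀ (E : List (Edge n)) {e} → e ∈ E →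
    countᵇ (meets e) E + 1 ≤ countᵇ (incident (proj₁ e)) E + countᵇ (incident (proj₂ e)) E
  countᵇ-meets+1≤ E {e} e∈ = begin
    countᵇ (meets e) E + 1                                            ≤⟨ +-monoʳ-≤ _ e-counted-twice ⟩
    countᵇ (meets e) E + countᵇ (λ f → incident (proj₁ e) f ∧ incident (proj₂ e) f) E ≡⟨ countᵇ-∨+countᵇ-∧ _ _ E ⟩
    countᵇ (incident (proj₁ e)) E + countᵇ (incident (proj₂ e)) E      ∎
    where
    open ≤-Reasoning
    e-counted-twice = countᵇ-pos _ E e∈ (cong₂ _∧_ (incident-proj₁ e) (incident-proj₂ e))

  allPairs-ordered : ∀ {f} → f ∈ allPairs n → Ordered f
  allPairs-ordered {a , b} f∈ =
    <ᵇ⇒< (toℕ a) (toℕ b) (proj₂ (∈-filter⁻ (T? ∘ λ p → proj₁ p <ᵇ proj₂ p) {xs = cartesianProduct (allFin n) (allFin n)} f∈))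

  allPairs-unique : Unique (allPairs n)
  allPairs-unique = Unique.filter⁺ _ (Unique.cartesianProduct⁺ (Unique.allFin⁺ n) (Unique.allFin⁺ n))

  module _ (G : Graph n) where

    edges-unique : Unique (edges G)
    edges-unique = Unique.filter⁺ _ allPairs-unique

    ∈-edges⁻ : ∀ {f} → f ∈ edges G → f ∈ allPairs n × adj G (proj₁ f) (proj₂ f) ≡ true
    ∈-edges⁻ f∈ with f∈P , adj-f ← ∈-filter⁻ (T? ∘ λ p → adj G (proj₁ p) (proj₂ p)) {xs = allPairs n} f∈ =
      f∈P , Equivalence.to T-≡ adj-f

    countᵇ-incident-≤-degree : ∀ u → countᵇ (incident u) (edges G) ≤ degree G u
    countᵇ-incident-≤-degree u =
      countᵇ-incident-≤ (edges G) u (adj G u) edges-unique (allPairs-ordered ∘ proj₁ ∘ ∈-edges⁻) adjacent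
      where
      adjacent : ∀ {f} → f ∈ edges G → incident u f ≡ true → adj G u (opposite u f) ≡ true
      adjacent {a , b} f∈ u∈f with u == a in u=a
      ... | true  rewrite ==⇒≡ u a u=a = proj₂ (∈-edges⁻ f∈)
      ... | false rewrite ==⇒≡ u b u∈f = trans (Graph.sym G b a) (proj₂ (∈-edges⁻ f∈))

    countᵇ-meets≤d'+1 : ∀ {e} → e ∈ edges G → countᵇ (meets e) (edges G) ≤ d' G e + 1
    countᵇ-meets≤d'+1 {u , v} e∈ =
      ≤∸2+1 (≤-trans (countᵇ-meets+1≤ (edges G) e∈)
                (+-mono-≤ (countᵇ-incident-≤-degree u) (countᵇ-incident-≤-degree v)))
            (≤-trans (countᵇ-pos (incident u) (edges G) e∈ (incident-proj₁ (u , v))) (countᵇ-incident-≤-degree u))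
            (≤-trans (countᵇ-pos (incident v) (edges G) e∈ (incident-proj₂ (u , v))) (countᵇ-incident-≤-degree v))
      where
      ≤∸2+1 : ∀ {c a b} → c + 1 ≤ a + b → 1 ≤ a → 1 ≤ b → c ≤ a + b ∸ 2 + 1
      ≤∸2+1 {c} {suc a} {suc b} c+1≤ (s≤s z≤n) (s≤s z≤n) =
        subst (λ z → c ≤ z + 1) (sym (cong (_∸ 1) (+-suc a b)))
          (+-cancelʳ-≤ 1 c (a + b + 1) (subst (c + 1 ≤_) (suc+suc a b) c+1≤))
        where suc+suc : ∀ a b → suc a + suc b ≡ a + b + 1 + 1
              suc+suc = solve-∀

    sumκ-≥-edges : length (edges G) * length (edges G) * length (perms (edges G))
                     ≤ sumκ (edges G) * (sumD' G + length (edges G))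
    sumκ-≥-edges = ≤-trans (sumκ-≥ E edges-unique) (*-monoʳ-≤ (sumκ E) sum-closedNbhd)
      where
      E = edges G
      sum-closedNbhd : closedNbhdSum E ≤ sumD' G + length E
      sum-closedNbhd = begin
        closedNbhdSum E                       ≤⟨ sum-map-mono _ _ E countᵇ-meets≤d'+1 ⟩
        sum (map (λ e → d' G e + 1) E)        ≡⟨ sum-map-+ (d' G) (λ _ → 1) E ⟩
        sumD' G + sum (map (λ _ → 1) E)       ≡⟨ cong (sumD' G +_) (trans (sum-map-const _ 1 E (λ _ → refl)) (*-identityʳ _)) ⟩
        sumD' G + length E                    ∎
        where open ≤-Reasoning

-- Sums over subsets

[1+k]*[1+n]C[1+k]≡[1+n]*nCk : ∀ n k → suc k * (suc n C suc k) ≡ suc n * (n C k)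
[1+k]*[1+n]C[1+k]≡[1+n]*nCk zero    zero    = refl
[1+k]*[1+n]C[1+k]≡[1+n]*nCk zero    (suc k) = *-zeroʳ (suc (suc k))
[1+k]*[1+n]C[1+k]≡[1+n]*nCk (suc n) zero    = trans (+-identityʳ _) (trans (nC1≡n (suc (suc n))) (sym (*-identityʳ _)))
[1+k]*[1+n]C[1+k]≡[1+n]*nCk (suc n) (suc k) = begin
  suc (suc k) * (suc (suc n) C suc (suc k))                       ≡⟨ cong (suc (suc k) *_) (nCk+nC[k+1]≡[n+1]C[k+1] (suc n) (suc k)) ⟨
  suc (suc k) * (suc n C suc k + suc n C suc (suc k))             ≡⟨ *-distribˡ-+ (suc (suc k)) (suc n C suc k) _ ⟩
  suc (suc k) * (suc n C suc k) + suc (suc k) * (suc n C suc (suc k))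
    ≡⟨ cong₂ (λ a b → suc n C suc k + a + b) ([1+k]*[1+n]C[1+k]≡[1+n]*nCk n k) ([1+k]*[1+n]C[1+k]≡[1+n]*nCk n (suc k)) ⟩
  suc n C suc k + suc n * (n C k) + suc n * (n C suc k)           ≡⟨ regroup (suc n C suc k) (suc n) (n C k) (n C suc k) ⟩
  suc n C suc k + suc n * (n C k + n C suc k)                     ≡⟨ cong (λ c → suc n C suc k + suc n * c) (nCk+nC[k+1]≡[n+1]C[k+1] n k) ⟩
  suc (suc n) * (suc n C suc k)                                   ∎
  where
  open ≡-Reasoning
  regroup : ∀ c m x y → c + m * x + m * y ≡ c + m * (x + y)
  regroup = solve-∀

length-choose : ∀ k (xs : List A) → length (choose k xs) ≡ length xs C k
length-choose zero    xs       = refl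
length-choose (suc k) []       = refl
length-choose (suc k) (x ∷ xs) = begin
  length (map (x ∷_) (choose k xs) ++ choose (suc k) xs)  ≡⟨ length-++ (map (x ∷_) (choose k xs)) ⟩
  length (map (x ∷_) (choose k xs)) + length (choose (suc k) xs)
    ≡⟨ cong₂ _+_ (trans (length-map (x ∷_) (choose k xs)) (length-choose k xs)) (length-choose (suc k) xs) ⟩
  length xs C k + length xs C suc k                        ≡⟨ nCk+nC[k+1]≡[n+1]C[k+1] (length xs) k ⟩
  suc (length xs) C suc k                                  ∎
  where open ≡-Reasoning

∈-choose⁻ : ∀ k (xs : List A) {H} → H ∈ choose k xs →
  length H ≡ k × (∀ {z} → z ∈ H → z ∈ xs) × (Unique xs → Unique H)
∈-choose⁻ zero    xs       (here refl) = refl , (λ ()) , (λ _ → [])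
∈-choose⁻ (suc k) (x ∷ xs) H∈ with ∈-++⁻ (map (x ∷_) (choose k xs)) H∈
... | inj₁ H∈' with H , H∈'' , refl ← ∈-map⁻ (x ∷_) H∈' with |H| , H⊆ , uH ← ∈-choose⁻ k xs H∈'' =
  cong suc |H| ,
  (λ { (here refl) → here refl ; (there z∈) → there (H⊆ z∈) }) ,
  λ { (x∉xs ∷ uxs) → All.tabulate (λ z∈ x≡z → All.lookup x∉xs (H⊆ z∈) x≡z) ∷ uH uxs }
... | inj₂ H∈' with |H| , H⊆ , uH ← ∈-choose⁻ (suc k) xs H∈' =
  |H| , there ∘ H⊆ , λ { (_ ∷ uxs) → uH uxs }

sum-map-choose-∷ : ∀ (φ : List A → ℕ) k x xs →
  sum (map φ (choose (suc k) (x ∷ xs))) ≡ sum (map (φ ∘ (x ∷_)) (choose k xs)) + sum (map φ (choose (suc k) xs))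
sum-map-choose-∷ φ k x xs = begin
  sum (map φ (map (x ∷_) (choose k xs) ++ choose (suc k) xs))
    ≡⟨ cong sum (map-++ φ (map (x ∷_) (choose k xs)) (choose (suc k) xs)) ⟩
  sum (map φ (map (x ∷_) (choose k xs)) ++ map φ (choose (suc k) xs))
    ≡⟨ sum-++ (map φ (map (x ∷_) (choose k xs))) _ ⟩
  sum (map φ (map (x ∷_) (choose k xs))) + sum (map φ (choose (suc k) xs))
    ≡⟨ cong (λ l → sum l + sum (map φ (choose (suc k) xs))) (map-∘ (choose k xs)) ⟨
  sum (map (φ ∘ (x ∷_)) (choose k xs)) + sum (map φ (choose (suc k) xs)) ∎
  where open ≡-Reasoning

module _ (g : A → ℕ) where

  private
    Σg : List A → ℕ
    Σg H = sum (map g H)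

  sum-map-sum-∷ : ∀ x (Hs : List (List A)) → sum (map (Σg ∘ (x ∷_)) Hs) ≡ length Hs * g x + sum (map Σg Hs)
  sum-map-sum-∷ x Hs = trans (sum-map-+ (λ _ → g x) Σg Hs) (cong (_+ sum (map Σg Hs)) (sum-map-const _ (g x) Hs (λ _ → refl)))

  sum-choose-sum : ∀ k x xs → sum (map Σg (choose (suc k) (x ∷ xs))) ≡ (length xs C k) * Σg (x ∷ xs)
  sum-choose-sum zero    x []       = refl
  sum-choose-sum (suc k) x []       = refl
  sum-choose-sum zero    x (y ∷ ys) = begin
    sum (map Σg (choose 1 (x ∷ y ∷ ys)))              ≡⟨ sum-map-choose-∷ Σg 0 x (y ∷ ys) ⟩
    (g x + 0) + 0 + sum (map Σg (choose 1 (y ∷ ys)))  ≡⟨ cong ((g x + 0) + 0 +_) (sum-choose-sum 0 y ys) ⟩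
    (g x + 0) + 0 + 1 * Σg (y ∷ ys)                    ≡⟨ simplify (g x) (Σg (y ∷ ys)) ⟩
    1 * Σg (x ∷ y ∷ ys)                                ∎
    where
    open ≡-Reasoning
    simplify : ∀ a s → (a + 0) + 0 + 1 * s ≡ 1 * (a + s)
    simplify = solve-∀
  sum-choose-sum (suc k) x (y ∷ ys) = begin
    sum (map Σg (choose (suc (suc k)) (x ∷ y ∷ ys)))
      ≡⟨ sum-map-choose-∷ Σg (suc k) x (y ∷ ys) ⟩
    sum (map (Σg ∘ (x ∷_)) (choose (suc k) (y ∷ ys))) + sum (map Σg (choose (suc (suc k)) (y ∷ ys)))
      ≡⟨ cong₂ _+_ (sum-map-sum-∷ x (choose (suc k) (y ∷ ys))) (sum-choose-sum (suc k) y ys) ⟩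
    length (choose (suc k) (y ∷ ys)) * g x + sum (map Σg (choose (suc k) (y ∷ ys))) + b * Σg (y ∷ ys)
      ≡⟨ cong₂ (λ c d → c * g x + d + b * Σg (y ∷ ys))
           (trans (length-choose (suc k) (y ∷ ys)) (sym (nCk+nC[k+1]≡[n+1]C[k+1] (length ys) k)))
           (sum-choose-sum k y ys) ⟩
    (a + b) * g x + a * Σg (y ∷ ys) + b * Σg (y ∷ ys)
      ≡⟨ collect a b (g x) (Σg (y ∷ ys)) ⟩
    (a + b) * Σg (x ∷ y ∷ ys)
      ≡⟨ cong (_* Σg (x ∷ y ∷ ys)) (nCk+nC[k+1]≡[n+1]C[k+1] (length ys) k) ⟩
    (length (y ∷ ys) C suc k) * Σg (x ∷ y ∷ ys)
      ∎
    where
    open ≡-Reasoning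
    a = length ys C k
    b = length ys C suc k
    collect : ∀ a b c s → (a + b) * c + a * s + b * s ≡ (a + b) * (c + s)
    collect = solve-∀

-- (a ∸ 1) C (k ∸ 1), except that it vanishes when a or k is 0.
C-pred : ℕ → ℕ → ℕ
C-pred a       zero    = 0
C-pred zero    (suc k) = 0
C-pred (suc a) (suc k) = a C k

C-pred+C-pred : ∀ a j → C-pred (suc a) j + C-pred (suc a) (suc j) ≡ suc a C j
C-pred+C-pred a zero    = refl
C-pred+C-pred a (suc j) = nCk+nC[k+1]≡[n+1]C[k+1] a j

C-pred-absorb : ∀ a k → C-pred a k * (suc a * a) ≡ suc k * k * (suc a C suc k)
C-pred-absorb a       zero    = refl
C-pred-absorb zero    (suc k) = sym (*-zeroʳ (suc (suc k) * suc k))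
C-pred-absorb (suc a) (suc k) = begin
  (a C k) * (suc (suc a) * suc a)                          ≡⟨ rotate (a C k) (suc (suc a)) (suc a) ⟩
  suc (suc a) * (suc a * (a C k))                          ≡⟨ cong (suc (suc a) *_) ([1+k]*[1+n]C[1+k]≡[1+n]*nCk a k) ⟨
  suc (suc a) * (suc k * (suc a C suc k))                  ≡⟨ swap-front (suc (suc a)) (suc k) (suc a C suc k) ⟩
  suc k * (suc (suc a) * (suc a C suc k))                  ≡⟨ cong (suc k *_) ([1+k]*[1+n]C[1+k]≡[1+n]*nCk (suc a) (suc k)) ⟨
  suc k * (suc (suc k) * (suc (suc a) C suc (suc k)))      ≡⟨ reassoc (suc k) (suc (suc k)) (suc (suc a) C suc (suc k)) ⟩
  suc (suc k) * suc k * (suc (suc a) C suc (suc k))        ∎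
  where
  open ≡-Reasoning
  rotate : ∀ x y z → x * (y * z) ≡ y * (z * x)
  rotate = solve-∀
  swap-front : ∀ x y z → x * (y * z) ≡ y * (x * z)
  swap-front = solve-∀
  reassoc : ∀ x y z → x * (y * z) ≡ y * x * z
  reassoc = solve-∀

module _ (w : A → A → ℕ) where

  pairSum : List A → ℕ
  pairSum H = sum (map (λ e → sum (map (w e) H)) H)

  diagSum : List A → ℕ
  diagSum H = sum (map (λ e → w e e) H)

  crossSum : A → List A → ℕ
  crossSum x H = sum (map (λ f → w x f + w f x) H)

  offDiagSum : List A → ℕ
  offDiagSum []      = 0
  offDiagSum (x ∷ H) = crossSum x H + offDiagSum H

  pairSum≡diagSum+offDiagSum : ∀ H → pairSum H ≡ diagSum H + offDiagSum H
  pairSum≡diagSum+offDiagSum []      = refl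
  pairSum≡diagSum+offDiagSum (x ∷ H) = begin
    (w x x + sum (map (w x) H)) + sum (map (λ e → w e x + sum (map (w e) H)) H)
      ≡⟨ cong ((w x x + sum (map (w x) H)) +_) (sum-map-+ (λ e → w e x) (λ e → sum (map (w e) H)) H) ⟩
    (w x x + sum (map (w x) H)) + (sum (map (λ e → w e x) H) + pairSum H)
      ≡⟨ regroup (w x x) (sum (map (w x) H)) (sum (map (λ e → w e x) H)) (pairSum H) ⟩
    w x x + ((sum (map (w x) H) + sum (map (λ e → w e x) H)) + pairSum H)
      ≡⟨ cong₂ (λ c p → w x x + (c + p)) (sym (sum-map-+ (w x) (λ f → w f x) H)) (pairSum≡diagSum+offDiagSum H) ⟩
    w x x + (crossSum x H + (diagSum H + offDiagSum H))
      ≡⟨ regroup′ (w x x) (crossSum x H) (diagSum H) (offDiagSum H) ⟩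
    (w x x + diagSum H) + (crossSum x H + offDiagSum H) ∎
    where
    open ≡-Reasoning
    regroup : ∀ a b c d → (a + b) + (c + d) ≡ a + ((b + c) + d)
    regroup = solve-∀
    regroup′ : ∀ a b c d → a + (b + (c + d)) ≡ (a + c) + (b + d)
    regroup′ = solve-∀

  sum-choose-offDiagSum : ∀ k x xs →
    sum (map offDiagSum (choose (suc k) (x ∷ xs))) ≡ C-pred (length xs) k * offDiagSum (x ∷ xs)
  sum-choose-offDiagSum zero    x []       = refl
  sum-choose-offDiagSum (suc k) x []       = refl
  sum-choose-offDiagSum zero    x (y ∷ ys) = sum-choose-offDiagSum zero y ys
  sum-choose-offDiagSum (suc j) x (y ∷ ys) = begin
    sum (map offDiagSum (choose (suc (suc j)) (x ∷ y ∷ ys)))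
      ≡⟨ sum-map-choose-∷ offDiagSum (suc j) x (y ∷ ys) ⟩
    sum (map (offDiagSum ∘ (x ∷_)) (choose (suc j) (y ∷ ys))) + sum (map offDiagSum (choose (suc (suc j)) (y ∷ ys)))
      ≡⟨ cong (_+ _) (sum-map-+ (crossSum x) offDiagSum (choose (suc j) (y ∷ ys))) ⟩
    (sum (map (crossSum x) (choose (suc j) (y ∷ ys))) + sum (map offDiagSum (choose (suc j) (y ∷ ys))))
      + sum (map offDiagSum (choose (suc (suc j)) (y ∷ ys)))
      ≡⟨ cong₂ _+_ (cong₂ _+_ (sum-choose-sum (λ f → w x f + w f x) j y ys) (sum-choose-offDiagSum j y ys))
                   (sum-choose-offDiagSum (suc j) y ys) ⟩
    ((length ys C j) * crossSum x (y ∷ ys) + C-pred (length ys) j * O) + C-pred (length ys) (suc j) * O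
      ≡⟨ collect (length ys C j) (crossSum x (y ∷ ys)) (C-pred (length ys) j) (C-pred (length ys) (suc j)) O ⟩
    (length ys C j) * crossSum x (y ∷ ys) + (C-pred (length ys) j + C-pred (length ys) (suc j)) * O
      ≡⟨ cong ((length ys C j) * crossSum x (y ∷ ys) +_) (pascal ys) ⟩
    (length ys C j) * crossSum x (y ∷ ys) + (length ys C j) * O
      ≡⟨ *-distribˡ-+ (length ys C j) (crossSum x (y ∷ ys)) O ⟨
    (length ys C j) * offDiagSum (x ∷ y ∷ ys) ∎
    where
    open ≡-Reasoning
    O = offDiagSum (y ∷ ys)
    collect : ∀ a s c d o → (a * s + c * o) + d * o ≡ a * s + (c + d) * o
    collect = solve-∀
    pascal : ∀ ys → (C-pred (length ys) j + C-pred (length ys) (suc j)) * offDiagSum (y ∷ ys) ≡ (length ys C j) * offDiagSum (y ∷ ys)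
    pascal []       = trans (*-zeroʳ (C-pred 0 j + C-pred 0 (suc j))) (sym (*-zeroʳ (0 C j)))
    pascal (z ∷ zs) = cong (_* offDiagSum (y ∷ z ∷ zs)) (C-pred+C-pred (length zs) j)

  -- Of the (k+1)-subsets of x ∷ xs, |xs| C k contain a given element and C-pred |xs| k
  -- contain two given ones.
  sum-choose-pairSum : ∀ k x xs → sum (map pairSum (choose (suc k) (x ∷ xs))) ≡
    (length xs C k) * diagSum (x ∷ xs) + C-pred (length xs) k * offDiagSum (x ∷ xs)
  sum-choose-pairSum k x xs = begin
    sum (map pairSum Hs)                                    ≡⟨ cong sum (map-cong pairSum≡diagSum+offDiagSum Hs) ⟩
    sum (map (λ H → diagSum H + offDiagSum H) Hs)           ≡⟨ sum-map-+ diagSum offDiagSum Hs ⟩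
    sum (map diagSum Hs) + sum (map offDiagSum Hs)          ≡⟨ cong₂ _+_ (sum-choose-sum (λ e → w e e) k x xs) (sum-choose-offDiagSum k x xs) ⟩
    (length xs C k) * diagSum (x ∷ xs) + C-pred (length xs) k * offDiagSum (x ∷ xs) ∎
    where
    open ≡-Reasoning
    Hs = choose (suc k) (x ∷ xs)

module _ (w : A → A → ℕ) (c : ℕ) where

  sum-choose-pairSum-≤ : ∀ k xs → diagSum w xs ≡ length xs →
    (c + 1) * offDiagSum w xs ≤ 4 * length xs * (length xs ∸ 1) →
    (c + 1) * sum (map (pairSum w) (choose (suc k) xs)) ≤ (length xs C suc k) * suc k * (4 * suc k + c ∸ 3)
  sum-choose-pairSum-≤ k []       _    _   = ≤-reflexive (*-zeroʳ (c + 1))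
  sum-choose-pairSum-≤ k (x ∷ ys) diag off = begin
    (c + 1) * sum (map (pairSum w) (choose (suc k) (x ∷ ys)))
      ≡⟨ cong ((c + 1) *_) (sum-choose-pairSum w k x ys) ⟩
    (c + 1) * ((L' C k) * diagSum w (x ∷ ys) + C-pred L' k * O)
      ≡⟨ cong (λ d → (c + 1) * ((L' C k) * d + C-pred L' k * O)) diag ⟩
    (c + 1) * ((L' C k) * suc L' + C-pred L' k * O)
      ≡⟨ distribute (c + 1) ((L' C k) * suc L') (C-pred L' k) O ⟩
    (c + 1) * ((L' C k) * suc L') + C-pred L' k * ((c + 1) * O)
      ≤⟨ +-monoʳ-≤ _ (*-monoʳ-≤ (C-pred L' k) off) ⟩
    (c + 1) * ((L' C k) * suc L') + C-pred L' k * (4 * suc L' * L')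
      ≡⟨ cong₂ (λ p q → (c + 1) * p + q) absorb (trans (four-out (C-pred L' k) (suc L') L') (cong (4 *_) (C-pred-absorb L' k))) ⟩
    (c + 1) * (suc k * M) + 4 * (suc k * k * M)
      ≡⟨ collect c k M ⟩
    M * suc k * (4 * k + c + 1)
      ≡⟨ cong (M * suc k *_) (4[1+k]+c∸3 k c) ⟨
    M * suc k * (4 * suc k + c ∸ 3) ∎
    where
    open ≤-Reasoning
    L' = length ys
    O = offDiagSum w (x ∷ ys)
    M = suc L' C suc k
    absorb : (L' C k) * suc L' ≡ suc k * M
    absorb = trans (*-comm (L' C k) (suc L')) (sym ([1+k]*[1+n]C[1+k]≡[1+n]*nCk L' k))
    distribute : ∀ a p b o → a * (p + b * o) ≡ a * p + b * (a * o)
    distribute = solve-∀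
    four-out : ∀ b l l' → b * (4 * l * l') ≡ 4 * (b * (l * l'))
    four-out = solve-∀
    collect : ∀ c k M → (c + 1) * (suc k * M) + 4 * (suc k * k * M) ≡ M * suc k * (4 * k + c + 1)
    collect = solve-∀
    4[1+k]+c∸3 : ∀ k c → 4 * suc k + c ∸ 3 ≡ 4 * k + c + 1
    4[1+k]+c∸3 k c = trans (cong (_∸ 3) (three+ k c)) (m+n∸m≡n 3 (4 * k + c + 1))
      where three+ : ∀ k c → 4 * suc k + c ≡ 3 + (4 * k + c + 1)
            three+ = solve-∀

-- The random graph G(n, m)

module _ {n : ℕ} where

  private
    indicators : ∀ {a b c x y z} → a ≡ x → b ≡ y → c ≡ z →
      indicator a + indicator b + indicator c ≡ indicator x + indicator y + indicator z
    indicators refl refl refl = refl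

  exactly-one-order : ∀ (i j : Fin n) → indicator (i <ᵇ j) + indicator (j <ᵇ i) + indicator (j == i) ≡ 1
  exactly-one-order i j with <-cmp (toℕ i) (toℕ j)
  ... | tri< i<j i≢j _ = indicators (dec-true (toℕ i <? toℕ j) i<j) (dec-false (toℕ j <? toℕ i) (<⇒≯ i<j))
                           (≢⇒==-false (i≢j ∘ sym ∘ cong toℕ))
  ... | tri> _ i≢j j<i = indicators (dec-false (toℕ i <? toℕ j) (<⇒≯ j<i)) (dec-true (toℕ j <? toℕ i) j<i)
                           (≢⇒==-false (i≢j ∘ sym ∘ cong toℕ))
  ... | tri≈ _ i≡j _ rewrite toℕ-injective i≡j =
    indicators (dec-false (toℕ j <? toℕ j) (<-irrefl refl)) (dec-false (toℕ j <? toℕ j) (<-irrefl refl)) (==-refl j)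

  countᵇ-== : ∀ (x : Fin n) xs → Unique xs → x ∈ xs → countᵇ (_== x) xs ≡ 1
  countᵇ-== x (y ∷ xs) (y∉xs ∷ _) (here refl) rewrite ==-refl y = cong suc (none xs y∉xs)
    where
    none : ∀ zs → All.All (y ≢_) zs → countᵇ (_== y) zs ≡ 0
    none []       All.[]           = refl
    none (z ∷ zs) (y≢z All.∷ y∉zs) with z ≟ y
    ... | yes refl = contradiction refl y≢z
    ... | no _     = none zs y∉zs
  countᵇ-== x (y ∷ xs) (y∉xs ∷ uxs) (there x∈) with y ≟ x
  ... | yes refl = contradiction refl (All.lookup y∉xs x∈)
  ... | no _     = countᵇ-== x xs uxs x∈

  length-allFin : length (allFin n) ≡ n
  length-allFin = length-tabulate (λ i → i)

  length-allPairs : length (allPairs n) + length (allPairs n) + n ≡ n * n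
  length-allPairs = begin
    L + L + n
      ≡⟨ cong₂ (λ a b → a + b + n) L≡Σ< (trans L≡Σ< (sum-map-countᵇ-swap (λ j i → i <ᵇ j) (allFin n) (allFin n))) ⟩
    Σ (λ i → countᵇ (i <ᵇ_) (allFin n)) + Σ (λ i → countᵇ (_<ᵇ i) (allFin n)) + n
      ≡⟨ cong (Σ (λ i → countᵇ (i <ᵇ_) (allFin n)) + Σ (λ i → countᵇ (_<ᵇ i) (allFin n)) +_) Σ=≡n ⟨
    Σ (λ i → countᵇ (i <ᵇ_) (allFin n)) + Σ (λ i → countᵇ (_<ᵇ i) (allFin n)) + Σ (λ i → countᵇ (_== i) (allFin n))
      ≡⟨ cong (_+ Σ (λ i → countᵇ (_== i) (allFin n))) (sum-map-+ _ _ (allFin n)) ⟨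
    Σ (λ i → countᵇ (i <ᵇ_) (allFin n) + countᵇ (_<ᵇ i) (allFin n)) + Σ (λ i → countᵇ (_== i) (allFin n))
      ≡⟨ sum-map-+ _ _ (allFin n) ⟨
    Σ (λ i → countᵇ (i <ᵇ_) (allFin n) + countᵇ (_<ᵇ i) (allFin n) + countᵇ (_== i) (allFin n))
      ≡⟨ sum-map-const _ n (allFin n) (λ {i} _ →
           trans (countᵇ-trichotomy (i <ᵇ_) (_<ᵇ i) (_== i) (allFin n) (exactly-one-order i)) length-allFin) ⟩
    length (allFin n) * n
      ≡⟨ cong (_* n) length-allFin ⟩
    n * n ∎
    where
    open ≡-Reasoning
    L = length (allPairs n)
    Σ : (Fin n → ℕ) → ℕ
    Σ f = sum (map f (allFin n))
    L≡Σ< : L ≡ Σ (λ i → countᵇ (i <ᵇ_) (allFin n))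
    L≡Σ< = countᵇ-cartesianProduct (λ p → proj₁ p <ᵇ proj₂ p) (allFin n) (allFin n)
    Σ=≡n : Σ (λ i → countᵇ (_== i) (allFin n)) ≡ n
    Σ=≡n = trans (sum-map-const _ 1 (allFin n) (λ {i} i∈ → countᵇ-== i (allFin n) (Unique.allFin⁺ n) i∈))
             (trans (*-identityʳ _) length-allFin)

  countᵇ-incident-allPairs : ∀ u → countᵇ (incident u) (allPairs n) + 1 ≤ n
  countᵇ-incident-allPairs u = begin
    countᵇ (incident u) (allPairs n) + 1
      ≤⟨ +-monoˡ-≤ 1 (countᵇ-incident-≤ (allPairs n) u (not ∘ (_== u)) allPairs-unique allPairs-ordered opposite≢u) ⟩
    countᵇ (not ∘ (_== u)) (allFin n) + 1
      ≡⟨ cong (countᵇ (not ∘ (_== u)) (allFin n) +_) (countᵇ-== u (allFin n) (Unique.allFin⁺ n) (∈-allFin u)) ⟨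
    countᵇ (not ∘ (_== u)) (allFin n) + countᵇ (_== u) (allFin n)
      ≡⟨ +-comm _ (countᵇ (_== u) (allFin n)) ⟩
    countᵇ (_== u) (allFin n) + countᵇ (not ∘ (_== u)) (allFin n)
      ≡⟨ trans (countᵇ+countᵇ-not (_== u) (allFin n)) length-allFin ⟩
    n ∎
    where
    open ≤-Reasoning
    opposite≢u : ∀ {f} → f ∈ allPairs n → incident u f ≡ true → not (opposite u f == u) ≡ true
    opposite≢u {a , b} f∈ u∈f with u == a in u=a
    ... | true  with refl ← ==⇒≡ u a u=a = cong not (≢⇒==-false (λ { refl → <-irrefl refl (allPairs-ordered f∈) }))
    ... | false with refl ← ==⇒≡ u b u∈f = cong not (≢⇒==-false (λ { refl → <-irrefl refl (allPairs-ordered f∈) }))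

  countᵇ-meets-allPairs : ∀ {e} → e ∈ allPairs n → countᵇ (meets e) (allPairs n) + 3 ≤ 2 * n
  countᵇ-meets-allPairs {u , v} e∈ = begin
    countᵇ (meets (u , v)) P + 3           ≡⟨ +-assoc _ 1 2 ⟨
    countᵇ (meets (u , v)) P + 1 + 2       ≤⟨ +-monoˡ-≤ 2 (countᵇ-meets+1≤ P e∈) ⟩
    countᵇ (incident u) P + countᵇ (incident v) P + 2
      ≡⟨ regroup (countᵇ (incident u) P) (countᵇ (incident v) P) ⟩
    (countᵇ (incident u) P + 1) + (countᵇ (incident v) P + 1)
      ≤⟨ +-mono-≤ (countᵇ-incident-allPairs u) (countᵇ-incident-allPairs v) ⟩
    n + n                                  ≡⟨ cong (n +_) (+-identityʳ n) ⟨
    2 * n                                  ∎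
    where
    open ≤-Reasoning
    P = allPairs n
    regroup : ∀ a b → a + b + 2 ≡ (a + 1) + (b + 1)
    regroup = solve-∀

  meetsᵢ : Edge n → Edge n → ℕ
  meetsᵢ e f = indicator (meets e f)

  closedNbhdSum≡pairSum : ∀ H → closedNbhdSum H ≡ pairSum meetsᵢ H
  closedNbhdSum≡pairSum H = cong sum (map-cong (λ e → countᵇ≡sum-indicator (meets e) H) H)

  diagSum-meetsᵢ : ∀ H → diagSum meetsᵢ H ≡ length H
  diagSum-meetsᵢ H =
    trans (sum-map-const _ 1 H (λ {e} _ → cong indicator (meets-refl e))) (*-identityʳ (length H))

  offDiagSum-allPairs : (n + 1) * offDiagSum meetsᵢ (allPairs n) ≤ 4 * length (allPairs n) * (length (allPairs n) ∸ 1)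
  offDiagSum-allPairs = begin
    (n + 1) * O                          ≤⟨ m+n≤o⇒m≤o∸n _ (+-cancelʳ-≤ (4 * n * L) _ _ scaled) ⟩
    4 * L * L ∸ 4 * L                    ≡⟨ cong (4 * L * L ∸_) (*-identityʳ (4 * L)) ⟨
    4 * L * L ∸ 4 * L * 1                ≡⟨ *-distribˡ-∸ (4 * L) L 1 ⟨
    4 * L * (L ∸ 1)                      ∎
    where
    open ≤-Reasoning
    P = allPairs n
    L = length P
    O = offDiagSum meetsᵢ P
    closed-bound : closedNbhdSum P + L * 3 ≤ L * (2 * n)
    closed-bound = begin
      closedNbhdSum P + L * 3                 ≡⟨ cong (closedNbhdSum P +_) (sum-map-const (λ _ → 3) 3 P (λ _ → refl)) ⟨
      closedNbhdSum P + sum (map (λ _ → 3) P) ≡⟨ sum-map-+ (λ e → countᵇ (meets e) P) (λ _ → 3) P ⟨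
      sum (map (λ e → countᵇ (meets e) P + 3) P) ≤⟨ sum-map-mono _ _ P countᵇ-meets-allPairs ⟩
      sum (map (λ _ → 2 * n) P)               ≡⟨ sum-map-const _ (2 * n) P (λ _ → refl) ⟩
      L * (2 * n)                             ∎
    unscaled : O + 4 * L ≤ L * (2 * n)
    unscaled = begin
      O + 4 * L                      ≡⟨ rearrange O L ⟩
      (L + O) + L * 3                ≡⟨ cong (λ d → (d + O) + L * 3) (diagSum-meetsᵢ P) ⟨
      (diagSum meetsᵢ P + O) + L * 3 ≡⟨ cong (_+ L * 3) (trans (closedNbhdSum≡pairSum P) (pairSum≡diagSum+offDiagSum meetsᵢ P)) ⟨
      closedNbhdSum P + L * 3        ≤⟨ closed-bound ⟩
      L * (2 * n)                    ∎
      where rearrange : ∀ o l → o + 4 * l ≡ (l + o) + l * 3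
            rearrange = solve-∀
    scaled : (n + 1) * O + 4 * L + 4 * n * L ≤ 4 * L * L + 4 * n * L
    scaled = begin
      (n + 1) * O + 4 * L + 4 * n * L ≡⟨ expand n O L ⟩
      (n + 1) * (O + 4 * L)           ≤⟨ *-monoʳ-≤ (n + 1) unscaled ⟩
      (n + 1) * (L * (2 * n))         ≡⟨ via-n² n L ⟩
      2 * L * (n * n) + 2 * n * L     ≡⟨ cong (λ s → 2 * L * s + 2 * n * L) length-allPairs ⟨
      2 * L * (L + L + n) + 2 * n * L ≡⟨ collect n L ⟩
      4 * L * L + 4 * n * L           ∎
      where
      expand : ∀ n o l → (n + 1) * o + 4 * l + 4 * n * l ≡ (n + 1) * (o + 4 * l)
      expand = solve-∀
      via-n² : ∀ n l → (n + 1) * (l * (2 * n)) ≡ 2 * l * (n * n) + 2 * n * l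
      via-n² = solve-∀
      collect : ∀ n l → 2 * l * (l + l + n) + 2 * n * l ≡ 4 * l * l + 4 * n * l
      collect = solve-∀

eliminate-middle : ∀ {M m c F X Φ Q} → 1 ≤ m → M * M * (m * m * F) ≤ X * Φ → (c + 1) * Φ ≤ M * m * Q →
  (m * c + m) * (M * F) ≤ X * Q
eliminate-middle {zero}  {m} {c} _ _ _ = ≤-trans (≤-reflexive (*-zeroʳ (m * c + m))) z≤n
eliminate-middle {suc M} {suc k} {c} {F} {X} {Φ} {Q} _ cauchy nbhd =
  *-cancelˡ-≤ (suc M * suc k) (begin
    suc M * suc k * ((suc k * c + suc k) * (suc M * F)) ≡⟨ regroup (suc M) (suc k) c F ⟩
    (c + 1) * (suc M * suc M * (suc k * suc k * F))   ≤⟨ *-monoʳ-≤ (c + 1) cauchy ⟩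
    (c + 1) * (X * Φ)                                 ≡⟨ swap-front (c + 1) X Φ ⟩
    X * ((c + 1) * Φ)                                 ≤⟨ *-monoʳ-≤ X nbhd ⟩
    X * (suc M * suc k * Q)                           ≡⟨ swap-front X (suc M * suc k) Q ⟩
    suc M * suc k * (X * Q)                           ∎)
  where
  open ≤-Reasoning
  regroup : ∀ M m c F → M * m * ((m * c + m) * (M * F)) ≡ (c + 1) * (M * M * (m * m * F))
  regroup = solve-∀
  swap-front : ∀ x y z → x * (y * z) ≡ y * (x * z)
  swap-front = solve-∀

sumκ-≥-random : ∀ n m → (m * n + m) * sum (map (λ H → length (perms H)) (choose m (allPairs n)))
                          ≤ sum (map sumκ (choose m (allPairs n))) * (4 * m + n ∸ 3)
sumκ-≥-random n zero        = z≤n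
sumκ-≥-random n m@(suc k) = begin
  (m * n + m) * sum (map (λ H → length (perms H)) Hs) ≡⟨ cong ((m * n + m) *_) perms-total ⟩
  (m * n + m) * (M * m !)                               ≤⟨ eliminate-middle {M} {m} {n} {m !} {X} {Φ} (s≤s z≤n) cauchy-schwarz nbhd-bound ⟩
  X * (4 * m + n ∸ 3)                                   ∎
  where
  open ≤-Reasoning
  P = allPairs n
  Hs = choose m P
  M = length Hs
  X = sum (map sumκ Hs)
  Φ = sum (map closedNbhdSum Hs)
  |H|≡m : ∀ {H} → H ∈ Hs → length H ≡ m
  |H|≡m H∈ = proj₁ (∈-choose⁻ m P H∈)
  unique : ∀ {H} → H ∈ Hs → Unique H
  unique H∈ = proj₂ (proj₂ (∈-choose⁻ m P H∈)) allPairs-unique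
  perms-total : sum (map (λ H → length (perms H)) Hs) ≡ M * m !
  perms-total = sum-map-const _ (m !) Hs (λ {H} H∈ → trans (length-perms H) (cong _! (|H|≡m H∈)))
  cauchy-schwarz : M * M * (m * m * m !) ≤ X * Φ
  cauchy-schwarz = length²*≤sum*sum sumκ closedNbhdSum (m * m * m !) Hs λ {H} H∈ →
    subst (λ l → l * l * l ! ≤ sumκ H * closedNbhdSum H) (|H|≡m H∈)
      (subst (λ p → length H * length H * p ≤ sumκ H * closedNbhdSum H) (length-perms H) (sumκ-≥ H (unique H∈)))
  nbhd-bound : (n + 1) * Φ ≤ M * m * (4 * m + n ∸ 3)
  nbhd-bound = begin
    (n + 1) * Φ                              ≡⟨ cong (λ s → (n + 1) * sum s) (map-cong closedNbhdSum≡pairSum Hs) ⟩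
    (n + 1) * sum (map (pairSum meetsᵢ) Hs)  ≤⟨ sum-choose-pairSum-≤ meetsᵢ n k P (diagSum-meetsᵢ P) (offDiagSum-allPairs {n}) ⟩
    (length P C m) * m * (4 * m + n ∸ 3)     ≡⟨ cong (λ c → c * m * (4 * m + n ∸ 3)) (length-choose m P) ⟨
    M * m * (4 * m + n ∸ 3)                  ∎

-- Neither bound needs its size hypotheses: for m = 0 or m > n C 2 both inequalities are trivial.
corollary5 :
    ((n : ℕ) (G : Graph n) → 1 ≤ length (edges G) →
       length (edges G) * length (edges G) * length (perms (edges G))
         ≤ sumκ (edges G) * (sumD' G + length (edges G)))
    ×
    ((n m : ℕ) → 1 ≤ m → m ≤ n C 2 →
       (m * n + m) * sum (map (λ H → length (perms H)) (choose m (allPairs n)))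
         ≤ sum (map sumκ (choose m (allPairs n))) * (4 * m + n ∸ 3))
corollary5 = (λ n G _ → sumκ-≥-edges G) , (λ n m _ _ → sumκ-≥-random n m)
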